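{- Let $T_1=\{12,1\overline{2},\overline{1}2\}$, $T_2=\{12,1\overline{2},\overline{1}\,\overline{2}\}$, $T_3=\{12,1\overline{2},21\}$, $T_4=\{12,1\overline{2},2\overline{1}\}$, $T_5=\{12,1\overline{2},\overline{2}1\}$, $T_6=\{12,1\overline{2},\overline{2}\,\overline{1}\}$, $T_7=\{12,\overline{1}\,\overline{2},21\}$, $T_8=\{12,\overline{1}\,\overline{2},2\overline{1}\}$, $T_9=\{12,2\overline{1},\overline{2}1\}$ and $T_{10}=\{1\overline{2},\overline{1}2,2\overline{1}\}$. Then for every integer $n\ge 0$: \[ b_n(T_1)=\sum_{d=0}^n\ \sum_{\substack{i_0+i_1+\cdots+i_d=n-d\\ i_0,\dots,i_d\ge 0}}\ \prod_{j=0}^d i_j!; \] \[ b_n(T_2)=C_{n+1}; \] \[ b_n(T_3)=n!+n!\sum_{j=1}^n\frac{1}{j}; \] \[ b_n(T_4)=b_n(T_5)=n!\sum_{j=0}^n\frac{1}{j!}; \] \[ b_n(T_6)=F_{2n+1}; \] \[ b_n(T_7)=n^2+1; \] \[ b_n(T_8)=2^{n+1}-(n+1); \] \[ b_n(T_9)=n!+\sum_{j=1}^n\ \sum_{\substack{p+q=n-j\\ p,q\ge 0}}p!\,q!; \] \[ b_n(T_{10})=n!\sum_{j=0}^n\binom{n}{j}^{ -1}. \]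
   Context: A signed permutation of length $n$ is a word $\alpha=\alpha_1\alpha_2\cdots\alpha_n$ in which each of the symbols $1,2,\dots,n$ appears exactly once, each occurrence possibly barred (written $\overline{i}$). The set of all of them is the hyperoctahedral group $B_n$, and $B_0$ consists of the empty word. For a symbol $x$, $|x|$ denotes the underlying number with any bar removed. For $\tau=\tau_1\cdots\tau_k\in B_k$ and $\alpha\in B_n$, $\alpha$ contains the signed pattern $\tau$ if there are indices $1\le i_1<\cdots<i_k\le n$ such that (1) for all $p,q$, $|\alpha_{i_p}|>|\alpha_{i_q}|$ if and only if $|\tau_p|>|\tau_q|$, and (2) for every $j$, $\alpha_{i_j}$ is barred if and only if $\tau_j$ is barred. Otherwise $\alpha$ avoids $\tau$. For a set $T$ of signed patterns, $B_n(T)$ is the set of $\alpha\in B_n$ avoiding every $\tau\in T$, and $b_n(T)=|B_n(T)|$. $C_m=\frac{1}{m+1}\binom{2m}{m}$ is the $m$-th Catalan number. $F_m$ is the $m$-th Fibonacci number, with $F_0=0$, $F_1=1$ and $F_{m}=F_{m-1}+F_{m-2}$. -}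

module Defs where

open import Data.Nat using (ℕ; zero; suc; _+_; _*_; _∸_; _≤_; _<_; _!)
open import Data.Nat.Combinatorics using (_C_)
open import Data.Nat.DivMod using (_/_)
open import Data.Bool using (Bool; true; false)
open import Data.Fin using (Fin)
import Data.Fin as F
open import Data.List using (List; []; _∷_; length; lookup; map)
open import Data.List.Membership.Propositional using (_∈_)
open import Data.List.Relation.Unary.Unique.Propositional using (Unique)
open import Data.Product using (_×_; _,_; proj₁; proj₂; ∃; Σ)
open import Data.Integer using (+_)
open import Data.Rational using (ℚ; 0ℚ) renaming (_/_ to _/ℚ_; _+_ to _+ℚ_)
open import Relation.Binary.PropositionalEquality using (_≡_)
open import Relation.Nullary using (¬_)
open import Function.Bundles using (_⇔_)

-- Signed letters and words.  A letter is a pair (v , b): v is the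
-- underlying number |x| and b = true iff the letter is barred.

Letter : Set
Letter = ℕ × Bool

∣_∣ˡ : Letter → ℕ
∣ x ∣ˡ = proj₁ x

barred : Letter → Bool
barred = proj₂

Word : Set
Word = List Letter

u : ℕ → Letter
u v = (v , false)

o : ℕ → Letter
o v = (v , true)

IsSignedPerm : ℕ → Word → Set
IsSignedPerm n α =
  length α ≡ n
  × (∀ {v} → v ∈ map ∣_∣ˡ α → (1 ≤ v × v ≤ n))
  × Unique (map ∣_∣ˡ α)

Contains : Word → Word → Set
Contains α τ =
  Σ (Fin (length τ) → Fin (length α)) λ ι →
    (∀ p q → p F.< q → ι p F.< ι q)
    × (∀ p q → (∣ lookup τ q ∣ˡ < ∣ lookup τ p ∣ˡ) ⇔ (∣ lookup α (ι q) ∣ˡ < ∣ lookup α (ι p) ∣ˡ))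
    × (∀ j → barred (lookup α (ι j)) ≡ barred (lookup τ j))

Avoids : List Word → Word → Set
Avoids T α = ∀ {τ} → τ ∈ T → ¬ Contains α τ

-- b_n(T) = k : the set B_n(T) has exactly k elements, witnessed by a
-- duplicate-free list enumerating exactly the members of B_n(T).
bCard : ℕ → List Word → ℕ → Set
bCard n T k =
  ∃ λ (L : List Word) →
    Unique L
    × (∀ α → (α ∈ L) ⇔ (IsSignedPerm n α × Avoids T α))
    × length L ≡ k

-- Σ_{j=a}^{b} f j  (empty if b < a), over ℕ
sumFromTo : ℕ → ℕ → (ℕ → ℕ) → ℕ
sumFromTo a b f = go (suc b ∸ a)
  where
  go : ℕ → ℕ
  go zero = 0
  go (suc m) = f (a + m) + go m

sumFromToℚ : ℕ → ℕ → (ℕ → ℚ) → ℚ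
sumFromToℚ a b f = go (suc b ∸ a)
  where
  go : ℕ → ℚ
  go zero = 0ℚ
  go (suc m) = f (a + m) +ℚ go m

-- Sum over weak compositions (i_1,…,i_k) of s (i.e. i_j ≥ 0,
-- i_1+⋯+i_k = s) of the product i_1!⋯i_k!.
compFactSum : (k s : ℕ) → ℕ
compFactSum zero zero = 1
compFactSum zero (suc s) = 0
compFactSum (suc k) s = sumFromTo 0 s (λ i → (i !) * compFactSum k (s ∸ i))

ℕtoℚ : ℕ → ℚ
ℕtoℚ k = (+ k) /ℚ 1

-- 1/m as a rational (only ever applied to m ≥ 1; 1/0 := 0 by convention)
recip : ℕ → ℚ
recip zero = 0ℚ
recip (suc m) = (+ 1) /ℚ (suc m)

catalan : ℕ → ℕ
catalan m = ((2 * m) C m) / (suc m)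

fib : ℕ → ℕ
fib zero = 0
fib (suc zero) = 1
fib (suc (suc m)) = fib (suc m) + fib m

T₁ T₂ T₃ T₄ T₅ T₆ T₇ T₈ T₉ T₁₀ : List Word
T₁  = (u 1 ∷ u 2 ∷ []) ∷ (u 1 ∷ o 2 ∷ []) ∷ (o 1 ∷ u 2 ∷ []) ∷ []
T₂  = (u 1 ∷ u 2 ∷ []) ∷ (u 1 ∷ o 2 ∷ []) ∷ (o 1 ∷ o 2 ∷ []) ∷ []
T₃  = (u 1 ∷ u 2 ∷ []) ∷ (u 1 ∷ o 2 ∷ []) ∷ (u 2 ∷ u 1 ∷ []) ∷ []
T₄  = (u 1 ∷ u 2 ∷ []) ∷ (u 1 ∷ o 2 ∷ []) ∷ (u 2 ∷ o 1 ∷ []) ∷ []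
T₅  = (u 1 ∷ u 2 ∷ []) ∷ (u 1 ∷ o 2 ∷ []) ∷ (o 2 ∷ u 1 ∷ []) ∷ []
T₆  = (u 1 ∷ u 2 ∷ []) ∷ (u 1 ∷ o 2 ∷ []) ∷ (o 2 ∷ o 1 ∷ []) ∷ []
T₇  = (u 1 ∷ u 2 ∷ []) ∷ (o 1 ∷ o 2 ∷ []) ∷ (u 2 ∷ u 1 ∷ []) ∷ []
T₈  = (u 1 ∷ u 2 ∷ []) ∷ (o 1 ∷ o 2 ∷ []) ∷ (u 2 ∷ o 1 ∷ []) ∷ []
T₉  = (u 1 ∷ u 2 ∷ []) ∷ (u 2 ∷ o 1 ∷ []) ∷ (o 2 ∷ u 1 ∷ []) ∷ []
T₁₀ = (u 1 ∷ o 2 ∷ []) ∷ (o 1 ∷ u 2 ∷ []) ∷ (u 2 ∷ o 1 ∷ []) ∷ []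

-- Every pattern has length two, so a signed permutation avoids T exactly when
-- no pair of its letters has a forbidden shape: the relative order of the two
-- values together with the two bars.  Deleting the largest letter n of an avoider
-- leaves an avoider of length n − 1; conversely n, barred or not, may be inserted
-- exactly where every letter before it and every letter after it forms an allowed
-- pair with it, and that depends only on the bars.  So b_n(T) is computed by a
-- transfer recursion on a small summary of the bar word (typically the length of
-- an initial run of barred letters), and for each of the ten classes the
-- recursion is solved by elementary factorial and binomial identities.

{-# OPTIONS --safe #-}
module Submission where

open import Defs
open import Data.Nat using (ℕ; zero; suc; _+_; _*_; _∸_; _^_; _!; _≤_; _<_; _<ᵇ_; z≤n; s≤s; _≟_; NonZero)
open import Data.Nat.Properties
open import Data.Nat.Combinatorics using (_C_; nCk+nC[k+1]≡[n+1]C[k+1]; k>n⇒nCk≡0; nCk≡n!/k![n-k]!; k![n∸k]!∣n!; nCn≡1; nCk≡nC[n∸k])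
open import Data.Nat.Divisibility using (∣-trans; m≤n⇒m!∣n!; m∣m*n)
open import Data.Nat.DivMod using (_/_; m/n*n≡m; m*n/n≡m; /-congˡ)
open import Data.Nat.ListAction using (sum)
open import Data.Nat.ListAction.Properties using (sum-++)
open import Data.Nat.Solver using (module +-*-Solver)
open +-*-Solver using (solve; _:+_; _:*_; _:=_; con)
import Data.Integer as ℤ
import Data.Integer.Properties as ℤ
open import Data.Rational using (ℚ; 0ℚ; toℚᵘ) renaming (_+_ to _+ℚ_; _*_ to _*ℚ_)
import Data.Rational.Properties as ℚ
open import Data.Rational.Unnormalised as ℚᵘ using (mkℚᵘ; *≡*)
import Data.Rational.Unnormalised.Properties as ℚᵘ
open import Data.Bool using (Bool; true; false; T; _∧_; if_then_else_)
import Data.Bool.Properties as Bool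
open import Data.Bool.ListAction using (all)
open import Data.Unit using (tt)
open import Data.Empty using (⊥; ⊥-elim)
open import Data.Fin using (Fin; zero; suc)
import Data.Fin as Fin
open import Data.List using (List; []; _∷_; _++_; length; lookup; map; concatMap; foldr)
import Data.List.Properties
open import Data.List.Properties using (length-map; map-++; map-∘; ++-identityʳ; concatMap-cong; concatMap-++; ∷-injectiveˡ; ∷-injectiveʳ)
open import Data.List.Membership.Propositional using (_∈_; _∉_; find; lose)
open import Data.List.Membership.Propositional.Properties
  using (∈-lookup; ∈-map⁺; ∈-map⁻; ∈-++⁺ˡ; ∈-++⁺ʳ; ∈-++⁻; ∈-∃++; ∈-concatMap⁺; ∈-concatMap⁻)
open import Data.List.Membership.DecPropositional _≟_ using (_∈?_)
open import Data.List.Relation.Unary.Any as Any using (Any; here; there; any?)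
open import Data.List.Relation.Unary.Any.Properties using (lookup-index)
open import Data.List.Relation.Unary.All as All using (All; []; _∷_)
import Data.List.Relation.Unary.All.Properties as All
open import Data.List.Relation.Unary.AllPairs using ([]; _∷_)
open import Data.List.Relation.Unary.Unique.Propositional using (Unique)
import Data.List.Relation.Unary.Unique.Propositional.Properties as Unique
open import Data.Product using (∃; ∃₂; _×_; _,_; proj₁; proj₂; uncurry)
open import Data.Product.Properties using (≡-dec)
open import Data.Sum using (_⊎_; inj₁; inj₂)
import Data.Sum
open import Function using (_∘_)
open import Function.Bundles using (_⇔_; mk⇔; Equivalence)
open import Relation.Nullary using (¬_; Dec; yes; no; ¬?)
open import Relation.Nullary.Decidable using (isYes; toWitness; fromWitness)
open import Relation.Binary.PropositionalEquality

-- Length-two patterns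

Shape : Set
Shape = Bool × Bool × Bool × Bool

-- Both comparisons are kept, so that contains-pair⇔ needs no distinctness of values.
shape : Letter → Letter → Shape
shape x y = ((∣ x ∣ˡ <ᵇ ∣ y ∣ˡ) , (∣ y ∣ˡ <ᵇ ∣ x ∣ˡ) , barred x , barred y)

_≟ˢ_ : (s t : Shape) → Dec (s ≡ t)
_≟ˢ_ = ≡-dec Bool._≟_ (≡-dec Bool._≟_ (≡-dec Bool._≟_ Bool._≟_))

data SomePair (R : Letter → Letter → Set) : Word → Set where
  from-head : ∀ {x y α} → y ∈ α → R x y → SomePair R (x ∷ α)
  in-tail : ∀ {x α} → SomePair R α → SomePair R (x ∷ α)

SomePair-map : ∀ {R S : Letter → Letter → Set} {α} → (∀ {x y} → R x y → S x y) → SomePair R α → SomePair S α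
SomePair-map f (from-head y∈ r) = from-head y∈ (f r)
SomePair-map f (in-tail p) = in-tail (SomePair-map f p)

SomePair-Any : ∀ {A : Set} {R : A → Letter → Letter → Set} {as α} →
               SomePair (λ x y → Any (λ a → R a x y) as) α → Any (λ a → SomePair (R a) α) as
SomePair-Any (from-head y∈ r) = Any.map (from-head y∈) r
SomePair-Any (in-tail p) = Any.map in-tail (SomePair-Any p)

SomePair-lookup⁺ : ∀ {R} α (i j : Fin (length α)) → i Fin.< j → R (lookup α i) (lookup α j) → SomePair R α
SomePair-lookup⁺ (x ∷ α) zero (suc j) _ r = from-head (∈-lookup j) r
SomePair-lookup⁺ (x ∷ α) (suc i) (suc j) (s≤s i<j) r = in-tail (SomePair-lookup⁺ α i j i<j r)

SomePair-lookup⁻ : ∀ {R α} → SomePair R α →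
                   ∃₂ λ (i j : Fin (length α)) → i Fin.< j × R (lookup α i) (lookup α j)
SomePair-lookup⁻ {R} (from-head {x} y∈ r) =
  zero , suc (Any.index y∈) , s≤s z≤n , subst (R x) (lookup-index y∈) r
SomePair-lookup⁻ (in-tail p) =
  let i , j , i<j , r = SomePair-lookup⁻ p in suc i , suc j , s≤s i<j , r

T-⇔⇒≡ : ∀ {x y} → T x ⇔ T y → x ≡ y
T-⇔⇒≡ {false} {false} _ = refl
T-⇔⇒≡ {false} {true}  h = ⊥-elim (Equivalence.from h tt)
T-⇔⇒≡ {true}  {false} h = ⊥-elim (Equivalence.to h tt)
T-⇔⇒≡ {true}  {true}  _ = refl

<-⇔⇒<ᵇ-≡ : ∀ {a b c d} → (a < b) ⇔ (c < d) → (a <ᵇ b) ≡ (c <ᵇ d)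
<-⇔⇒<ᵇ-≡ {a} {b} {c} {d} h = T-⇔⇒≡ (mk⇔
  (λ t → <⇒<ᵇ (Equivalence.to h (<ᵇ⇒< a b t)))
  (λ t → <⇒<ᵇ (Equivalence.from h (<ᵇ⇒< c d t))))

<ᵇ-≡⇒<-⇔ : ∀ {a b c d} → (a <ᵇ b) ≡ (c <ᵇ d) → (a < b) ⇔ (c < d)
<ᵇ-≡⇒<-⇔ {a} {b} {c} {d} e = mk⇔
  (λ p → <ᵇ⇒< c d (subst T e (<⇒<ᵇ p)))
  (λ p → <ᵇ⇒< a b (subst T (sym e) (<⇒<ᵇ p)))

contains-pair⇔ : ∀ α t₁ t₂ → Contains α (t₁ ∷ t₂ ∷ []) ⇔ SomePair (λ x y → shape x y ≡ shape t₁ t₂) α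
contains-pair⇔ α t₁ t₂ = mk⇔ to from
  where
  to : Contains α (t₁ ∷ t₂ ∷ []) → SomePair (λ x y → shape x y ≡ shape t₁ t₂) α
  to (ι , mono , ord , same-bars) =
    SomePair-lookup⁺ α (ι zero) (ι (suc zero)) (mono zero (suc zero) (s≤s z≤n))
      (sym (cong₂ _,_ (<-⇔⇒<ᵇ-≡ (ord (suc zero) zero))
           (cong₂ _,_ (<-⇔⇒<ᵇ-≡ (ord zero (suc zero)))
           (sym (cong₂ _,_ (same-bars zero) (same-bars (suc zero)))))))
  from : SomePair (λ x y → shape x y ≡ shape t₁ t₂) α → Contains α (t₁ ∷ t₂ ∷ [])
  from p with SomePair-lookup⁻ p
  ... | i , j , i<j , e = ι , mono , ord , same-bars
    where
    ι : Fin 2 → Fin (length α)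
    ι zero = i
    ι (suc zero) = j
    mono : ∀ p q → p Fin.< q → ι p Fin.< ι q
    mono zero (suc zero) _ = i<j
    mono (suc zero) (suc zero) (s≤s ())
    irrefl⇔ : ∀ {a b} → (a < a) ⇔ (b < b)
    irrefl⇔ = mk⇔ (⊥-elim ∘ <-irrefl refl) (⊥-elim ∘ <-irrefl refl)
    ord : ∀ p q → (∣ lookup (t₁ ∷ t₂ ∷ []) q ∣ˡ < ∣ lookup (t₁ ∷ t₂ ∷ []) p ∣ˡ)
                ⇔ (∣ lookup α (ι q) ∣ˡ < ∣ lookup α (ι p) ∣ˡ)
    ord zero zero = irrefl⇔
    ord zero (suc zero) = <ᵇ-≡⇒<-⇔ (sym (cong (proj₁ ∘ proj₂) e))
    ord (suc zero) zero = <ᵇ-≡⇒<-⇔ (sym (cong proj₁ e))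
    ord (suc zero) (suc zero) = irrefl⇔
    same-bars : ∀ q → barred (lookup α (ι q)) ≡ barred (lookup (t₁ ∷ t₂ ∷ []) q)
    same-bars zero = cong (proj₁ ∘ proj₂ ∘ proj₂) e
    same-bars (suc zero) = cong (proj₂ ∘ proj₂ ∘ proj₂) e

<ᵇ-true : ∀ {m n} → m < n → (m <ᵇ n) ≡ true
<ᵇ-true m<n = Equivalence.to Bool.T-≡ (<⇒<ᵇ m<n)

<ᵇ-false : ∀ {m n} → n < m → (m <ᵇ n) ≡ false
<ᵇ-false {m} {n} n<m with m <ᵇ n in eq
... | false = refl
... | true = ⊥-elim (<-asym n<m (<ᵇ⇒< m n (subst T (sym eq) tt)))

ascent descent : Bool → Bool → Shape
ascent c b = (true , false , c , b)
descent b c = (false , true , b , c)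

shape-ascent : ∀ {x y} → ∣ y ∣ˡ < ∣ x ∣ˡ → shape y x ≡ ascent (barred y) (barred x)
shape-ascent y<x rewrite <ᵇ-true y<x | <ᵇ-false y<x = refl

shape-descent : ∀ {x y} → ∣ y ∣ˡ < ∣ x ∣ˡ → shape x y ≡ descent (barred x) (barred y)
shape-descent y<x rewrite <ᵇ-true y<x | <ᵇ-false y<x = refl

module _ {A : Set} where

  ∈-insert⁻ : ∀ (xs : List A) {a ys v} → v ∈ xs ++ a ∷ ys → v ≡ a ⊎ v ∈ xs ++ ys
  ∈-insert⁻ [] (here e) = inj₁ e
  ∈-insert⁻ [] (there v∈) = inj₂ v∈
  ∈-insert⁻ (x ∷ xs) (here e) = inj₂ (here e)
  ∈-insert⁻ (x ∷ xs) (there v∈) = Data.Sum.map₂ there (∈-insert⁻ xs v∈)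

  ∈-insert⁺ : ∀ (xs : List A) {a ys v} → v ∈ xs ++ ys → v ∈ xs ++ a ∷ ys
  ∈-insert⁺ [] v∈ = there v∈
  ∈-insert⁺ (x ∷ xs) (here e) = here e
  ∈-insert⁺ (x ∷ xs) (there v∈) = there (∈-insert⁺ xs v∈)

  ∈-inserted : ∀ (xs : List A) {a ys} → a ∈ xs ++ a ∷ ys
  ∈-inserted [] = here refl
  ∈-inserted (x ∷ xs) = there (∈-inserted xs)

  length-insert : ∀ (xs : List A) {a ys} → length (xs ++ a ∷ ys) ≡ suc (length (xs ++ ys))
  length-insert [] = refl
  length-insert (x ∷ xs) = cong suc (length-insert xs)

  Unique-insert⁺ : ∀ (xs : List A) {a ys} → Unique (xs ++ ys) → a ∉ xs ++ ys → Unique (xs ++ a ∷ ys)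
  Unique-insert⁺ [] u a∉ = All.tabulate (λ v∈ a≡v → a∉ (subst (_∈ _) (sym a≡v) v∈)) ∷ u
  Unique-insert⁺ (x ∷ xs) {a} {ys} (x∉ ∷ u) a∉ = All.tabulate x≢ ∷ Unique-insert⁺ xs u (a∉ ∘ there)
    where
    x≢ : ∀ {v} → v ∈ xs ++ a ∷ ys → x ≢ v
    x≢ v∈ x≡v with ∈-insert⁻ xs v∈
    ... | inj₁ refl = a∉ (here (sym x≡v))
    ... | inj₂ v∈′ = All.lookup x∉ v∈′ x≡v

  Unique-insert⁻ : ∀ (xs : List A) {a ys} → Unique (xs ++ a ∷ ys) → Unique (xs ++ ys) × a ∉ xs ++ ys
  Unique-insert⁻ [] (a∉ ∷ u) = u , λ a∈ → All.lookup a∉ a∈ refl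
  Unique-insert⁻ (x ∷ xs) (x∉ ∷ u) with Unique-insert⁻ xs u
  ... | u′ , a∉ = All.tabulate (λ v∈ → All.lookup x∉ (∈-insert⁺ xs v∈)) ∷ u′
                , λ { (here refl) → All.lookup x∉ (∈-inserted xs) refl ; (there a∈) → a∉ a∈ }

unique-bounded-length : ∀ k (vs : List ℕ) → Unique vs → (∀ {v} → v ∈ vs → 1 ≤ v × v ≤ k) → length vs ≤ k
unique-bounded-length zero [] _ _ = z≤n
unique-bounded-length zero (v ∷ vs) _ bounded = ⊥-elim (<-irrefl refl (uncurry ≤-trans (bounded (here refl))))
unique-bounded-length (suc k) vs u bounded with suc k ∈? vs
... | no k+1∉ = m≤n⇒m≤1+n (unique-bounded-length k vs u (λ v∈ → below-top v∈ (λ e → k+1∉ (subst (_∈ vs) e v∈))))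
  where
  below-top : ∀ {v} → v ∈ vs → v ≢ suc k → 1 ≤ v × v ≤ k
  below-top v∈ v≢ = let 1≤v , v≤ = bounded v∈ in 1≤v , ≤-pred (≤∧≢⇒< v≤ v≢)
... | yes k+1∈ with ∈-∃++ k+1∈
... | xs , ys , refl with Unique-insert⁻ xs u
... | u′ , k+1∉ = subst (_≤ suc k) (sym (length-insert xs))
  (s≤s (unique-bounded-length k (xs ++ ys) u′ λ v∈ →
     let 1≤v , v≤ = bounded (∈-insert⁺ xs v∈)
     in 1≤v , ≤-pred (≤∧≢⇒< v≤ (λ e → k+1∉ (subst (_∈ _) e v∈)))))

module _ {A B : Set} where

  concatMap-concatMap : ∀ {C : Set} (g : B → List C) (f : A → List B) xs →
                        concatMap g (concatMap f xs) ≡ concatMap (concatMap g ∘ f) xs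
  concatMap-concatMap g f [] = refl
  concatMap-concatMap g f (x ∷ xs) =
    trans (concatMap-++ g (f x) _) (cong (concatMap g (f x) ++_) (concatMap-concatMap g f xs))

  length-concatMap : ∀ (f : A → List B) xs → length (concatMap f xs) ≡ sum (map (length ∘ f) xs)
  length-concatMap f [] = refl
  length-concatMap f (x ∷ xs) = trans (Data.List.Properties.length-++ (f x)) (cong (length (f x) +_) (length-concatMap f xs))

  Unique-concatMap : ∀ (f : A → List B) (g : B → A) {xs} → Unique xs → (∀ {a} → a ∈ xs → Unique (f a)) →
                     (∀ {a b} → a ∈ xs → b ∈ f a → g b ≡ a) → Unique (concatMap f xs)
  Unique-concatMap f g [] _ _ = []
  Unique-concatMap f g {a ∷ xs} (a∉ ∷ u) uf inv =
    Unique.++⁺ (uf (here refl)) (Unique-concatMap f g u (uf ∘ there) (inv ∘ there)) λ (b∈fa , b∈rest) →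
      let a′ , a′∈ , b∈fa′ = find (∈-concatMap⁻ f {xs = xs} b∈rest)
      in All.lookup a∉ a′∈ (trans (sym (inv (here refl) b∈fa)) (inv (there a′∈) b∈fa′))

module _ {R : Letter → Letter → Set} where

  SomePair-insert⁻ : ∀ xs {x ys} → SomePair R (xs ++ x ∷ ys) →
    SomePair R (xs ++ ys) ⊎ (∃ λ y → y ∈ xs × R y x) ⊎ (∃ λ y → y ∈ ys × R x y)
  SomePair-insert⁻ [] (from-head y∈ r) = inj₂ (inj₂ (_ , y∈ , r))
  SomePair-insert⁻ [] (in-tail p) = inj₁ p
  SomePair-insert⁻ (z ∷ xs) (from-head y∈ r) with ∈-insert⁻ xs y∈
  ... | inj₁ refl = inj₂ (inj₁ (z , here refl , r))
  ... | inj₂ y∈′ = inj₁ (from-head y∈′ r)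
  SomePair-insert⁻ (z ∷ xs) (in-tail p) with SomePair-insert⁻ xs p
  ... | inj₁ q = inj₁ (in-tail q)
  ... | inj₂ (inj₁ (y , y∈ , r)) = inj₂ (inj₁ (y , there y∈ , r))
  ... | inj₂ (inj₂ t) = inj₂ (inj₂ t)

  SomePair-insert⁺ : ∀ xs {x ys} → SomePair R (xs ++ ys) → SomePair R (xs ++ x ∷ ys)
  SomePair-insert⁺ [] p = in-tail p
  SomePair-insert⁺ (z ∷ xs) (from-head y∈ r) = from-head (∈-insert⁺ xs y∈) r
  SomePair-insert⁺ (z ∷ xs) (in-tail p) = in-tail (SomePair-insert⁺ xs p)

  SomePair-before : ∀ xs {x ys y} → y ∈ xs → R y x → SomePair R (xs ++ x ∷ ys)
  SomePair-before (z ∷ xs) (here refl) r = from-head (∈-inserted xs) r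
  SomePair-before (z ∷ xs) (there y∈) r = in-tail (SomePair-before xs y∈ r)

  SomePair-after : ∀ xs {x ys y} → y ∈ ys → R x y → SomePair R (xs ++ x ∷ ys)
  SomePair-after [] y∈ r = from-head y∈ r
  SomePair-after (z ∷ xs) y∈ r = in-tail (SomePair-after xs y∈ r)

vals : Word → List ℕ
vals = map ∣_∣ˡ

bars : Word → List Bool
bars = map barred

vals-insert : ∀ xs {x ys} → vals (xs ++ x ∷ ys) ≡ vals xs ++ ∣ x ∣ˡ ∷ vals ys
vals-insert xs = map-++ ∣_∣ˡ xs _

<-top : ∀ {n α y} → IsSignedPerm n α → y ∈ α → ∣ y ∣ˡ < suc n
<-top (_ , bounded , _) y∈ = s≤s (proj₂ (bounded (∈-map⁺ ∣_∣ˡ y∈)))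

top-∉ : ∀ {n α} → IsSignedPerm n α → suc n ∉ vals α
top-∉ (_ , bounded , _) n+1∈ = <-irrefl refl (proj₂ (bounded n+1∈))

top-∈ : ∀ {n β} → IsSignedPerm (suc n) β → suc n ∈ vals β
top-∈ {n} {β} (len , bounded , u) with suc n ∈? vals β
... | yes n+1∈ = n+1∈
... | no n+1∉ = ⊥-elim (<-irrefl refl (≤-trans (≤-reflexive (sym (trans (length-map ∣_∣ˡ β) len)))
    (unique-bounded-length n (vals β) u λ v∈ →
       let 1≤v , v≤ = bounded v∈ in 1≤v , ≤-pred (≤∧≢⇒< v≤ (λ e → n+1∉ (subst (_∈ vals β) e v∈))))))

IsSignedPerm-insertTop : ∀ {n} xs {x ys} → ∣ x ∣ˡ ≡ suc n → IsSignedPerm n (xs ++ ys) → IsSignedPerm (suc n) (xs ++ x ∷ ys)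
IsSignedPerm-insertTop {n} xs {x} {ys} top p@(len , bounded , u) = length′ , bounded′ , unique′
  where
  vals-++ : vals (xs ++ ys) ≡ vals xs ++ vals ys
  vals-++ = map-++ ∣_∣ˡ xs ys
  length′ : length (xs ++ x ∷ ys) ≡ suc n
  length′ = trans (length-insert xs) (cong suc len)
  bounded′ : ∀ {v} → v ∈ vals (xs ++ x ∷ ys) → 1 ≤ v × v ≤ suc n
  bounded′ v∈ with ∈-insert⁻ (vals xs) (subst (_ ∈_) (vals-insert xs) v∈)
  ... | inj₁ refl = subst (λ v → 1 ≤ v × v ≤ suc n) (sym top) (s≤s z≤n , ≤-refl)
  ... | inj₂ v∈′ = let 1≤v , v≤ = bounded (subst (_ ∈_) (sym vals-++) v∈′) in 1≤v , m≤n⇒m≤1+n v≤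
  unique′ : Unique (vals (xs ++ x ∷ ys))
  unique′ = subst Unique (sym (vals-insert xs)) (Unique-insert⁺ (vals xs) (subst Unique vals-++ u)
              (λ x∈ → top-∉ p (subst (_∈ _) top (subst (_ ∈_) (sym vals-++) x∈))))

IsSignedPerm-removeTop : ∀ {n} xs {x ys} → ∣ x ∣ˡ ≡ suc n → IsSignedPerm (suc n) (xs ++ x ∷ ys) → IsSignedPerm n (xs ++ ys)
IsSignedPerm-removeTop {n} xs {x} {ys} top (len , bounded , u) = length′ , bounded′ , subst Unique (sym vals-++) u′
  where
  vals-++ : vals (xs ++ ys) ≡ vals xs ++ vals ys
  vals-++ = map-++ ∣_∣ˡ xs ys
  u′,x∉ : Unique (vals xs ++ vals ys) × ∣ x ∣ˡ ∉ vals xs ++ vals ys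
  u′,x∉ = Unique-insert⁻ (vals xs) (subst Unique (vals-insert xs) u)
  u′ : Unique (vals xs ++ vals ys)
  u′ = proj₁ u′,x∉
  length′ : length (xs ++ ys) ≡ n
  length′ = suc-injective (trans (sym (length-insert xs)) len)
  bounded′ : ∀ {v} → v ∈ vals (xs ++ ys) → 1 ≤ v × v ≤ n
  bounded′ v∈ =
    let v∈′ = subst (_ ∈_) vals-++ v∈
        1≤v , v≤ = bounded (subst (_ ∈_) (sym (vals-insert xs)) (∈-insert⁺ (vals xs) v∈′))
    in 1≤v , ≤-pred (≤∧≢⇒< v≤ (λ e → proj₂ u′,x∉ (subst (_∈ _) (trans e (sym top)) v∈′)))

deleteValue : ℕ → Word → Word
deleteValue v [] = []
deleteValue v (y ∷ β) with ∣ y ∣ˡ ≟ v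
... | yes _ = β
... | no _ = y ∷ deleteValue v β

deleteValue-insert : ∀ {v} xs {x ys} → ∣ x ∣ˡ ≡ v → v ∉ vals xs → deleteValue v (xs ++ x ∷ ys) ≡ xs ++ ys
deleteValue-insert {v} [] {x} x≡v _ with ∣ x ∣ˡ ≟ v
... | yes _ = refl
... | no x≢v = ⊥-elim (x≢v x≡v)
deleteValue-insert {v} (z ∷ xs) x≡v v∉ with ∣ z ∣ˡ ≟ v
... | yes z≡v = ⊥-elim (v∉ (here (sym z≡v)))
... | no _ = cong (z ∷_) (deleteValue-insert xs x≡v (v∉ ∘ there))

-- Growing avoiders by inserting the largest letter

module Insertion (Tp : List (Letter × Letter)) where

  patterns : List Word
  patterns = map (λ (t₁ , t₂) → t₁ ∷ t₂ ∷ []) Tp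

  Forbidden : Shape → Set
  Forbidden s = Any (λ (t₁ , t₂) → s ≡ shape t₁ t₂) Tp

  forbidden? : (s : Shape) → Dec (Forbidden s)
  forbidden? s = any? (λ (t₁ , t₂) → s ≟ˢ shape t₁ t₂) Tp

  Avoider : Word → Set
  Avoider α = ¬ SomePair (λ x y → Forbidden (shape x y)) α

  Avoids⇔Avoider : ∀ α → Avoids patterns α ⇔ Avoider α
  Avoids⇔Avoider α = mk⇔ to from
    where
    to : Avoids patterns α → Avoider α
    to avoids p with find (SomePair-Any p)
    ... | (t₁ , t₂) , t∈ , q = avoids (∈-map⁺ _ t∈) (Equivalence.from (contains-pair⇔ α t₁ t₂) q)
    from : Avoider α → Avoids patterns α
    from avoider τ∈ c with ∈-map⁻ _ τ∈
    ... | (t₁ , t₂) , t∈ , refl = avoider (SomePair-map (lose t∈) (Equivalence.to (contains-pair⇔ α t₁ t₂) c))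

  -- Whether a new largest letter barred b may stand after, resp. before, a letter barred c.
  mayFollow mayPrecede : Bool → Bool → Bool
  mayFollow b c = isYes (¬? (forbidden? (ascent c b)))
  mayPrecede b c = isYes (¬? (forbidden? (descent b c)))

  Valid : Letter → Word → Word → Set
  Valid x xs ys = All (λ y → T (mayFollow (barred x) (barred y))) xs
                × All (λ y → T (mayPrecede (barred x) (barred y))) ys

  insertions : Letter → Word → List Word
  insertions x [] = (x ∷ []) ∷ []
  insertions x (y ∷ α) =
    (if all (mayPrecede (barred x)) (bars (y ∷ α)) then (x ∷ y ∷ α) ∷ [] else [])
    ++ (if mayFollow (barred x) (barred y) then map (y ∷_) (insertions x α) else [])

  ∈-insertions-∷⁻ : ∀ {x y α β} → β ∈ insertions x (y ∷ α) →
      (β ≡ x ∷ y ∷ α × T (all (mayPrecede (barred x)) (bars (y ∷ α))))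
    ⊎ (∃ λ β′ → β′ ∈ insertions x α × β ≡ y ∷ β′ × T (mayFollow (barred x) (barred y)))
  ∈-insertions-∷⁻ {x} {y} {α} {β} = split _ _
    where
    from-later : β ∈ map (y ∷_) (insertions x α) → ∃ λ β′ → β′ ∈ insertions x α × β ≡ y ∷ β′ × T true
    from-later β∈ = let β′ , β′∈ , β≡ = ∈-map⁻ _ β∈ in β′ , β′∈ , β≡ , tt
    split : ∀ a f → β ∈ (if a then (x ∷ y ∷ α) ∷ [] else []) ++ (if f then map (y ∷_) (insertions x α) else []) →
            (β ≡ x ∷ y ∷ α × T a) ⊎ (∃ λ β′ → β′ ∈ insertions x α × β ≡ y ∷ β′ × T f)
    split true  _     (here refl) = inj₁ (refl , tt)
    split true  true  (there β∈) = inj₂ (from-later β∈)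
    split false true  β∈ = inj₂ (from-later β∈)

  insertions-sound : ∀ x α {β} → β ∈ insertions x α →
                     ∃₂ λ xs ys → α ≡ xs ++ ys × β ≡ xs ++ x ∷ ys × Valid x xs ys
  insertions-sound x [] (here refl) = [] , [] , refl , refl , [] , []
  insertions-sound x (y ∷ α) β∈ with ∈-insertions-∷⁻ β∈
  ... | inj₁ (refl , front) = [] , y ∷ α , refl , refl , [] , All.map⁻ (All.all⁺ _ (bars (y ∷ α)) front)
  ... | inj₂ (β′ , β′∈ , refl , follows) with insertions-sound x α β′∈
  ... | xs , ys , refl , refl , before , after = y ∷ xs , ys , refl , refl , follows ∷ before , after

  insertions-front : ∀ x α → T (all (mayPrecede (barred x)) (bars α)) → x ∷ α ∈ insertions x α
  insertions-front x [] _ = here refl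
  insertions-front x (y ∷ α) front with all (mayPrecede (barred x)) (bars (y ∷ α))
  ... | true = here refl

  insertions-later : ∀ x y α {β} → T (mayFollow (barred x) (barred y)) → β ∈ insertions x α → y ∷ β ∈ insertions x (y ∷ α)
  insertions-later x y α follows β∈ with mayFollow (barred x) (barred y)
  ... | true = ∈-++⁺ʳ (if all (mayPrecede (barred x)) (bars (y ∷ α)) then (x ∷ y ∷ α) ∷ [] else []) (∈-map⁺ (y ∷_) β∈)

  insertions-complete : ∀ x xs ys → Valid x xs ys → xs ++ x ∷ ys ∈ insertions x (xs ++ ys)
  insertions-complete x [] ys (_ , after) = insertions-front x ys (All.all⁻ _ (All.map⁺ after))
  insertions-complete x (y ∷ xs) ys (follows ∷ before , after) =
    insertions-later x y (xs ++ ys) follows (insertions-complete x xs ys (before , after))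

  Unique-insertions : ∀ x α → x ∉ α → Unique (insertions x α)
  Unique-insertions x [] _ = [] ∷ []
  Unique-insertions x (y ∷ α) x∉ =
    Unique.++⁺ (unique-front (all (mayPrecede (barred x)) (bars (y ∷ α)))) (unique-later (mayFollow (barred x) (barred y)))
      λ (β∈front , β∈later) → let β′ , β≡ = later-head _ β∈later in
        x∉ (here (∷-injectiveˡ (trans (sym (front-≡ _ β∈front)) β≡)))
    where
    unique-front : ∀ a → Unique (if a then (x ∷ y ∷ α) ∷ [] else [])
    unique-front true = [] ∷ []
    unique-front false = []
    unique-later : ∀ f → Unique (if f then map (y ∷_) (insertions x α) else [])
    unique-later true = Unique.map⁺ ∷-injectiveʳ (Unique-insertions x α (x∉ ∘ there))
    unique-later false = []
    front-≡ : ∀ a {β} → β ∈ (if a then (x ∷ y ∷ α) ∷ [] else []) → β ≡ x ∷ y ∷ α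
    front-≡ true (here refl) = refl
    later-head : ∀ f {β} → β ∈ (if f then map (y ∷_) (insertions x α) else []) → ∃ λ β′ → β ≡ y ∷ β′
    later-head true β∈ = let β′ , _ , β≡ = ∈-map⁻ _ β∈ in β′ , β≡

  insertionWeight : Bool → (List Bool → ℕ) → List Bool → ℕ
  insertionWeight b k [] = k (b ∷ [])
  insertionWeight b k (c ∷ w) =
    (if all (mayPrecede b) (c ∷ w) then k (b ∷ c ∷ w) else 0)
    + (if mayFollow b c then insertionWeight b (k ∘ (c ∷_)) w else 0)

  insertionWeight-cong : ∀ b {k k′} w → (∀ v → k v ≡ k′ v) → insertionWeight b k w ≡ insertionWeight b k′ w
  insertionWeight-cong b [] k≗k′ = k≗k′ (b ∷ [])
  insertionWeight-cong b {k} {k′} (c ∷ w) k≗k′ = cong₂ _+_ (front (all (mayPrecede b) (c ∷ w))) (after (mayFollow b c))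
    where
    front : ∀ a → (if a then k (b ∷ c ∷ w) else 0) ≡ (if a then k′ (b ∷ c ∷ w) else 0)
    front true = k≗k′ (b ∷ c ∷ w)
    front false = refl
    after : ∀ f → (if f then insertionWeight b (k ∘ (c ∷_)) w else 0) ≡ (if f then insertionWeight b (k′ ∘ (c ∷_)) w else 0)
    after true = insertionWeight-cong b w (k≗k′ ∘ (c ∷_))
    after false = refl

  sum-insertions : ∀ (k : List Bool → ℕ) x α →
                   sum (map (k ∘ bars) (insertions x α)) ≡ insertionWeight (barred x) k (bars α)
  sum-insertions k x [] = +-identityʳ _
  sum-insertions k x (y ∷ α) = begin
      sum (map (k ∘ bars) (front-list ++ later-list))
        ≡⟨ cong sum (map-++ (k ∘ bars) front-list later-list) ⟩
      sum (map (k ∘ bars) front-list ++ map (k ∘ bars) later-list)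
        ≡⟨ sum-++ (map (k ∘ bars) front-list) _ ⟩
      sum (map (k ∘ bars) front-list) + sum (map (k ∘ bars) later-list)
        ≡⟨ cong₂ _+_ (front (all (mayPrecede (barred x)) (bars (y ∷ α)))) (after (mayFollow (barred x) (barred y))) ⟩
      insertionWeight (barred x) k (bars (y ∷ α)) ∎
    where
    open ≡-Reasoning
    front-list later-list : List Word
    front-list = if all (mayPrecede (barred x)) (bars (y ∷ α)) then (x ∷ y ∷ α) ∷ [] else []
    later-list = if mayFollow (barred x) (barred y) then map (y ∷_) (insertions x α) else []
    front : ∀ a → sum (map (k ∘ bars) (if a then (x ∷ y ∷ α) ∷ [] else [])) ≡ (if a then k (bars (x ∷ y ∷ α)) else 0)
    front true = +-identityʳ _
    front false = refl
    after : ∀ f → sum (map (k ∘ bars) (if f then map (y ∷_) (insertions x α) else []))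
                ≡ (if f then insertionWeight (barred x) (k ∘ (barred y ∷_)) (bars α) else 0)
    after true = trans (cong sum (sym (map-∘ (insertions x α)))) (sum-insertions (k ∘ (barred y ∷_)) x α)
    after false = refl

  extensionCount : List Bool → ℕ → ℕ
  extensionCount w zero = 1
  extensionCount w (suc m) =
    insertionWeight false (λ v → extensionCount v m) w + insertionWeight true (λ v → extensionCount v m) w

  grow : Word → List Word
  grow α = insertions (suc (length α) , false) α ++ insertions (suc (length α) , true) α

  extensions : ℕ → Word → List Word
  extensions zero α = α ∷ []
  extensions (suc m) α = concatMap (extensions m) (grow α)

  avoiders : ℕ → List Word
  avoiders n = extensions n []

  length-extensions : ∀ m α → length (extensions m α) ≡ extensionCount (bars α) m
  length-extensions zero α = refl
  length-extensions (suc m) α = begin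
      length (concatMap (extensions m) (grow α))
        ≡⟨ length-concatMap (extensions m) (grow α) ⟩
      sum (map (length ∘ extensions m) (grow α))
        ≡⟨ cong sum (Data.List.Properties.map-cong (length-extensions m) (grow α)) ⟩
      sum (map (count ∘ bars) (insertions x₀ α ++ insertions x₁ α))
        ≡⟨ cong sum (map-++ (count ∘ bars) (insertions x₀ α) _) ⟩
      sum (map (count ∘ bars) (insertions x₀ α) ++ map (count ∘ bars) (insertions x₁ α))
        ≡⟨ sum-++ (map (count ∘ bars) (insertions x₀ α)) _ ⟩
      sum (map (count ∘ bars) (insertions x₀ α)) + sum (map (count ∘ bars) (insertions x₁ α))
        ≡⟨ cong₂ _+_ (sum-insertions count x₀ α) (sum-insertions count x₁ α) ⟩
      extensionCount (bars α) (suc m) ∎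
    where
    open ≡-Reasoning
    count : List Bool → ℕ
    count v = extensionCount v m
    x₀ x₁ : Letter
    x₀ = (suc (length α) , false)
    x₁ = (suc (length α) , true)

  extensions-suc : ∀ m α → extensions (suc m) α ≡ concatMap grow (extensions m α)
  extensions-suc zero α = trans (Data.List.Properties.concatMap-pure (grow α)) (sym (++-identityʳ (grow α)))
  extensions-suc (suc m) α = begin
      concatMap (extensions (suc m)) (grow α)
        ≡⟨ concatMap-cong (extensions-suc m) (grow α) ⟩
      concatMap (concatMap grow ∘ extensions m) (grow α)
        ≡⟨ concatMap-concatMap grow (extensions m) (grow α) ⟨
      concatMap grow (extensions (suc m) α) ∎
    where open ≡-Reasoning

  module _ {x y : Letter} (y<x : ∣ y ∣ˡ < ∣ x ∣ˡ) where

    mayFollow-sound : T (mayFollow (barred x) (barred y)) → ¬ Forbidden (shape y x)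
    mayFollow-sound t = subst (¬_ ∘ Forbidden) (sym (shape-ascent y<x)) (toWitness t)

    mayFollow-complete : ¬ Forbidden (shape y x) → T (mayFollow (barred x) (barred y))
    mayFollow-complete ¬f = fromWitness (subst (¬_ ∘ Forbidden) (shape-ascent y<x) ¬f)

    mayPrecede-sound : T (mayPrecede (barred x) (barred y)) → ¬ Forbidden (shape x y)
    mayPrecede-sound t = subst (¬_ ∘ Forbidden) (sym (shape-descent y<x)) (toWitness t)

    mayPrecede-complete : ¬ Forbidden (shape x y) → T (mayPrecede (barred x) (barred y))
    mayPrecede-complete ¬f = fromWitness (subst (¬_ ∘ Forbidden) (shape-descent y<x) ¬f)

  ∈-grow⁻ : ∀ {n α β} → length α ≡ n → β ∈ grow α →
            ∃₂ λ xs ys → ∃ λ x → α ≡ xs ++ ys × β ≡ xs ++ x ∷ ys × ∣ x ∣ˡ ≡ suc n × Valid x xs ys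
  ∈-grow⁻ {α = α} refl β∈ with ∈-++⁻ (insertions (suc (length α) , false) α) β∈
  ... | inj₁ β∈₀ = let xs , ys , α≡ , β≡ , v = insertions-sound _ α β∈₀ in xs , ys , _ , α≡ , β≡ , refl , v
  ... | inj₂ β∈₁ = let xs , ys , α≡ , β≡ , v = insertions-sound _ α β∈₁ in xs , ys , _ , α≡ , β≡ , refl , v

  ∈-grow⁺ : ∀ xs ys x → ∣ x ∣ˡ ≡ suc (length (xs ++ ys)) → Valid x xs ys → xs ++ x ∷ ys ∈ grow (xs ++ ys)
  ∈-grow⁺ xs ys (_ , false) refl v = ∈-++⁺ˡ (insertions-complete _ xs ys v)
  ∈-grow⁺ xs ys (_ , true) refl v = ∈-++⁺ʳ _ (insertions-complete _ xs ys v)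

  grow-sound : ∀ {n α β} → IsSignedPerm n α → Avoider α → β ∈ grow α → IsSignedPerm (suc n) β × Avoider β
  grow-sound {α = α} p avoider β∈ with ∈-grow⁻ {α = α} (proj₁ p) β∈
  ... | xs , ys , x , refl , refl , top , before , after = IsSignedPerm-insertTop xs top p , avoider′
    where
    below : ∀ {y} → y ∈ xs ++ ys → ∣ y ∣ˡ < ∣ x ∣ˡ
    below y∈ = subst (_ <_) (sym top) (<-top p y∈)
    avoider′ : Avoider (xs ++ x ∷ ys)
    avoider′ q with SomePair-insert⁻ xs q
    ... | inj₁ q′ = avoider q′
    ... | inj₂ (inj₁ (y , y∈ , f)) = mayFollow-sound (below (∈-++⁺ˡ y∈)) (All.lookup before y∈) f
    ... | inj₂ (inj₂ (y , y∈ , f)) = mayPrecede-sound (below (∈-++⁺ʳ xs y∈)) (All.lookup after y∈) f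

  grow-complete : ∀ {n β} → IsSignedPerm (suc n) β → Avoider β →
                  ∃ λ α → (IsSignedPerm n α × Avoider α) × β ∈ grow α
  grow-complete {n} p avoider with ∈-map⁻ ∣_∣ˡ (top-∈ p)
  ... | x , x∈ , n+1≡ with ∈-∃++ x∈
  ... | xs , ys , refl = xs ++ ys , (p′ , avoider ∘ SomePair-insert⁺ xs) , ∈-grow⁺ xs ys x top′ valid
    where
    top : ∣ x ∣ˡ ≡ suc n
    top = sym n+1≡
    p′ : IsSignedPerm n (xs ++ ys)
    p′ = IsSignedPerm-removeTop xs top p
    top′ : ∣ x ∣ˡ ≡ suc (length (xs ++ ys))
    top′ = trans top (cong suc (sym (proj₁ p′)))
    below : ∀ {y} → y ∈ xs ++ ys → ∣ y ∣ˡ < ∣ x ∣ˡ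
    below y∈ = subst (_ <_) (sym top) (<-top p′ y∈)
    valid : Valid x xs ys
    valid = All.tabulate (λ y∈ → mayFollow-complete (below (∈-++⁺ˡ y∈)) (avoider ∘ SomePair-before xs y∈))
          , All.tabulate (λ y∈ → mayPrecede-complete (below (∈-++⁺ʳ xs y∈)) (avoider ∘ SomePair-after xs y∈))

  deleteValue-grow : ∀ {n α β} → IsSignedPerm n α → β ∈ grow α → deleteValue (suc n) β ≡ α
  deleteValue-grow {α = α} p β∈ with ∈-grow⁻ {α = α} (proj₁ p) β∈
  ... | xs , ys , x , refl , refl , top , _ =
    deleteValue-insert xs top (λ n+1∈ → top-∉ p (subst (_ ∈_) (sym (map-++ ∣_∣ˡ xs ys)) (∈-++⁺ˡ n+1∈)))

  Unique-grow : ∀ {n α} → IsSignedPerm n α → Unique (grow α)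
  Unique-grow {α = α} p = Unique.++⁺ (Unique-insertions _ α (top∉ false)) (Unique-insertions _ α (top∉ true)) disjoint
    where
    top∉ : ∀ b → (suc (length α) , b) ∉ α
    top∉ b x∈ = top-∉ p (subst (λ m → suc m ∈ vals α) (proj₁ p) (∈-map⁺ ∣_∣ˡ x∈))
    disjoint : ∀ {β} → β ∈ insertions (suc (length α) , false) α × β ∈ insertions (suc (length α) , true) α → ⊥
    disjoint (β∈₀ , β∈₁) with insertions-sound _ α β∈₀ | insertions-sound _ α β∈₁
    ... | xs , ys , refl , refl , _ | xs′ , _ , _ , β≡ , _
      with ∈-insert⁻ xs (subst (_ ∈_) (sym β≡) (∈-inserted xs′))
    ... | inj₂ x∈ = top∉ true x∈

  ∈-avoiders⁻ : ∀ n {β} → β ∈ avoiders n → IsSignedPerm n β × Avoider β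
  ∈-avoiders⁻ zero (here refl) = (refl , (λ ()) , []) , λ ()
  ∈-avoiders⁻ (suc n) β∈ with find (∈-concatMap⁻ grow {xs = avoiders n} (subst (_ ∈_) (extensions-suc n []) β∈))
  ... | α , α∈ , β∈′ = let p , avoider = ∈-avoiders⁻ n α∈ in grow-sound p avoider β∈′

  ∈-avoiders⁺ : ∀ n {β} → IsSignedPerm n β → Avoider β → β ∈ avoiders n
  ∈-avoiders⁺ zero {[]} _ _ = here refl
  ∈-avoiders⁺ (suc n) p avoider with grow-complete p avoider
  ... | α , (p′ , avoider′) , β∈ = subst (_ ∈_) (sym (extensions-suc n []))
                                     (∈-concatMap⁺ grow (lose (∈-avoiders⁺ n p′ avoider′) β∈))

  Unique-avoiders : ∀ n → Unique (avoiders n)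
  Unique-avoiders zero = [] ∷ []
  Unique-avoiders (suc n) = subst Unique (sym (extensions-suc n []))
    (Unique-concatMap grow (deleteValue (suc n)) (Unique-avoiders n)
      (λ α∈ → Unique-grow (proj₁ (∈-avoiders⁻ n α∈)))
      (λ α∈ → deleteValue-grow (proj₁ (∈-avoiders⁻ n α∈))))

  bCard-avoiders : ∀ n → bCard n patterns (extensionCount [] n)
  bCard-avoiders n = avoiders n , Unique-avoiders n , ∈⇔ , length-extensions n []
    where
    ∈⇔ : ∀ β → β ∈ avoiders n ⇔ (IsSignedPerm n β × Avoids patterns β)
    ∈⇔ β = mk⇔ (λ β∈ → let p , avoider = ∈-avoiders⁻ n β∈ in p , λ {τ} → Equivalence.from (Avoids⇔Avoider β) avoider {τ})
               (λ p,avoids → ∈-avoiders⁺ n (proj₁ p,avoids) (Equivalence.to (Avoids⇔Avoider β) (λ {τ} → proj₂ p,avoids {τ})))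

  -- A summary of bar words, updated as letters are prepended, that determines the insertion counts.
  module Transfer {State : Set} (start : State) (next : Bool → State → State)
    (precedesAll : Bool → State → Bool) (weight : Bool → (State → ℕ) → State → ℕ)
    (precedesAll-start : ∀ b → precedesAll b start ≡ true)
    (precedesAll-next : ∀ b c σ → precedesAll b (next c σ) ≡ mayPrecede b c ∧ precedesAll b σ)
    (weight-start : ∀ b g → weight b g start ≡ g (next b start))
    (weight-next : ∀ b c g σ → weight b g (next c σ) ≡
        (if precedesAll b (next c σ) then g (next b (next c σ)) else 0)
        + (if mayFollow b c then weight b (g ∘ next c) σ else 0))
    where

    state : List Bool → State
    state = foldr next start

    precedesAll-state : ∀ b w → all (mayPrecede b) w ≡ precedesAll b (state w)
    precedesAll-state b [] = sym (precedesAll-start b)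
    precedesAll-state b (c ∷ w) = trans (cong (mayPrecede b c ∧_) (precedesAll-state b w)) (sym (precedesAll-next b c (state w)))

    weight-state : ∀ b g w → insertionWeight b (g ∘ state) w ≡ weight b g (state w)
    weight-state b g [] = sym (weight-start b g)
    weight-state b g (c ∷ w) = begin
        (if all (mayPrecede b) (c ∷ w) then g (state (b ∷ c ∷ w)) else 0)
        + (if mayFollow b c then insertionWeight b (g ∘ state ∘ (c ∷_)) w else 0)
          ≡⟨ cong₂ (λ a r → (if a then g (state (b ∷ c ∷ w)) else 0) + (if mayFollow b c then r else 0))
                   (precedesAll-state b (c ∷ w)) (weight-state b (g ∘ next c) w) ⟩
        (if precedesAll b (state (c ∷ w)) then g (state (b ∷ c ∷ w)) else 0)
        + (if mayFollow b c then weight b (g ∘ next c) (state w) else 0)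
          ≡⟨ weight-next b c g (state w) ⟨
        weight b g (state (c ∷ w)) ∎
      where open ≡-Reasoning

    count : State → ℕ → ℕ
    count σ zero = 1
    count σ (suc m) = weight false (λ τ → count τ m) σ + weight true (λ τ → count τ m) σ

    extensionCount≡count : ∀ m w → extensionCount w m ≡ count (state w) m
    extensionCount≡count zero w = refl
    extensionCount≡count (suc m) w = cong₂ _+_ (counted false) (counted true)
      where
      counted : ∀ b → insertionWeight b (λ v → extensionCount v m) w ≡ weight b (λ τ → count τ m) (state w)
      counted b = trans (insertionWeight-cong b w (extensionCount≡count m)) (weight-state b (λ τ → count τ m) w)

    bCard-count : ∀ n → bCard n patterns (count start n)
    bCard-count n = subst (bCard n patterns) (extensionCount≡count n []) (bCard-avoiders n)

-- Sums, rising factorials and binomial coefficients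

∑< : ℕ → (ℕ → ℕ) → ℕ
∑< zero f = 0
∑< (suc n) f = f 0 + ∑< n (f ∘ suc)

syntax ∑< n (λ i → e) = ∑[ i < n ] e

∑<-suc : ∀ n f → ∑< (suc n) f ≡ ∑< n f + f n
∑<-suc zero f = +-identityʳ (f 0)
∑<-suc (suc n) f = trans (cong (f 0 +_) (∑<-suc n (f ∘ suc))) (sym (+-assoc (f 0) _ _))

∑<-cong< : ∀ n {f g} → (∀ i → i < n → f i ≡ g i) → ∑< n f ≡ ∑< n g
∑<-cong< zero _ = refl
∑<-cong< (suc n) f≡g = cong₂ _+_ (f≡g 0 (s≤s z≤n)) (∑<-cong< n (λ i i<n → f≡g (suc i) (s≤s i<n)))

∑<-cong : ∀ n {f g} → (∀ i → f i ≡ g i) → ∑< n f ≡ ∑< n g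
∑<-cong n f≡g = ∑<-cong< n (λ i _ → f≡g i)

∑<-+ : ∀ n f g → ∑[ i < n ] (f i + g i) ≡ ∑< n f + ∑< n g
∑<-+ zero f g = refl
∑<-+ (suc n) f g = trans (cong (f 0 + g 0 +_) (∑<-+ n (f ∘ suc) (g ∘ suc)))
  (solve 4 (λ a b c d → (a :+ b) :+ (c :+ d) := (a :+ c) :+ (b :+ d)) refl (f 0) (g 0) (∑< n (f ∘ suc)) (∑< n (g ∘ suc)))

∑<-* : ∀ n a f → ∑[ i < n ] (a * f i) ≡ a * ∑< n f
∑<-* zero a f = sym (*-zeroʳ a)
∑<-* (suc n) a f = trans (cong (a * f 0 +_) (∑<-* n a (f ∘ suc))) (sym (*-distribˡ-+ a (f 0) _))

∑<-reverse : ∀ n f → ∑< n f ≡ ∑[ i < n ] f (n ∸ suc i)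
∑<-reverse zero f = refl
∑<-reverse (suc n) f = begin
    f 0 + ∑< n (f ∘ suc)                 ≡⟨ cong (f 0 +_) (∑<-reverse n (f ∘ suc)) ⟩
    f 0 + ∑[ i < n ] f (suc (n ∸ suc i)) ≡⟨ cong (f 0 +_) (∑<-cong< n (λ i i<n → cong f (sym (+-∸-assoc 1 i<n)))) ⟩
    f 0 + ∑[ i < n ] f (n ∸ i)           ≡⟨ +-comm (f 0) _ ⟩
    ∑[ i < n ] f (n ∸ i) + f 0           ≡⟨ cong (λ k → ∑[ i < n ] f (n ∸ i) + f k) (n∸n≡0 n) ⟨
    ∑[ i < n ] f (n ∸ i) + f (n ∸ n)     ≡⟨ ∑<-suc n (λ i → f (n ∸ i)) ⟨
    ∑[ i < suc n ] f (n ∸ i)             ∎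
  where open ≡-Reasoning

sumFromTo-0 : ∀ b f → sumFromTo 0 b f ≡ ∑< (suc b) f
sumFromTo-0 zero f = refl
sumFromTo-0 (suc b) f = trans (cong (f (suc b) +_) (sumFromTo-0 b f)) (trans (+-comm (f (suc b)) _) (sym (∑<-suc (suc b) f)))

sumFromTo-1 : ∀ b f → sumFromTo 1 b f ≡ ∑< b (f ∘ suc)
sumFromTo-1 zero f = refl
sumFromTo-1 (suc b) f = trans (cong (f (suc b) +_) (sumFromTo-1 b f)) (trans (+-comm (f (suc b)) _) (sym (∑<-suc b (f ∘ suc))))

rising : ℕ → ℕ → ℕ
rising r zero = 1
rising r (suc m) = suc r * rising (suc r) m

!*rising : ∀ r m → r ! * rising r m ≡ (r + m) !
!*rising r zero = trans (*-identityʳ _) (cong _! (sym (+-identityʳ r)))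
!*rising r (suc m) = begin
    r ! * (suc r * rising (suc r) m) ≡⟨ *-assoc (r !) (suc r) _ ⟨
    r ! * suc r * rising (suc r) m   ≡⟨ cong (_* rising (suc r) m) (*-comm (r !) (suc r)) ⟩
    suc r ! * rising (suc r) m       ≡⟨ !*rising (suc r) m ⟩
    (suc r + m) !                    ≡⟨ cong _! (+-suc r m) ⟨
    (r + suc m) !                    ∎
  where open ≡-Reasoning

rising-0 : ∀ m → rising 0 m ≡ m !
rising-0 m = trans (sym (+-identityʳ (rising 0 m))) (!*rising 0 m)

rising-1 : ∀ m → rising 1 m ≡ suc m !
rising-1 m = trans (sym (+-identityʳ (rising 1 m))) (!*rising 1 m)

rising-suc : ∀ r m → rising r (suc m) ≡ rising r m * (r + suc m)
rising-suc r zero = solve 1 (λ r → (con 1 :+ r) :* con 1 := con 1 :* (r :+ con 1)) refl r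
rising-suc r (suc m) = begin
    suc r * rising (suc r) (suc m)              ≡⟨ cong (suc r *_) (rising-suc (suc r) m) ⟩
    suc r * (rising (suc r) m * (suc r + suc m)) ≡⟨ *-assoc (suc r) (rising (suc r) m) (suc r + suc m) ⟨
    rising r (suc m) * (suc r + suc m)           ≡⟨ cong (rising r (suc m) *_) (+-suc r (suc m)) ⟨
    rising r (suc m) * (r + suc (suc m))         ∎
  where open ≡-Reasoning

rising-hockey-stick : ∀ L m → suc m * ∑[ p < suc L ] rising p m ≡ rising L (suc m)
rising-hockey-stick zero m = begin
    suc m * (rising 0 m + 0) ≡⟨ cong (suc m *_) (trans (+-identityʳ _) (rising-0 m)) ⟩
    suc m * m !              ≡⟨ rising-1 m ⟨
    rising 1 m               ≡⟨ *-identityˡ _ ⟨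
    rising 0 (suc m)         ∎
  where open ≡-Reasoning
rising-hockey-stick (suc L) m = begin
    suc m * ∑[ p < suc (suc L) ] rising p m
      ≡⟨ cong (suc m *_) (∑<-suc (suc L) (λ p → rising p m)) ⟩
    suc m * (∑[ p < suc L ] rising p m + rising (suc L) m)
      ≡⟨ *-distribˡ-+ (suc m) _ (rising (suc L) m) ⟩
    suc m * ∑[ p < suc L ] rising p m + suc m * rising (suc L) m
      ≡⟨ cong (_+ suc m * rising (suc L) m) (rising-hockey-stick L m) ⟩
    suc L * rising (suc L) m + suc m * rising (suc L) m
      ≡⟨ *-distribʳ-+ (rising (suc L) m) (suc L) (suc m) ⟨
    (suc L + suc m) * rising (suc L) m
      ≡⟨ *-comm _ (rising (suc L) m) ⟩
    rising (suc L) m * (suc L + suc m)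
      ≡⟨ rising-suc (suc L) m ⟨
    rising (suc L) (suc m) ∎
  where open ≡-Reasoning

n!/[j+1]*[j+1]≡n! : ∀ n j → suc j ≤ n → (n ! / suc j) * suc j ≡ n !
n!/[j+1]*[j+1]≡n! n j j<n = m/n*n≡m (∣-trans (m∣m*n (j !)) (m≤n⇒m!∣n! j<n))

nCk*k![n∸k]!≡n! : ∀ n k → k ≤ n → (n C k) * (k ! * (n ∸ k) !) ≡ n !
nCk*k![n∸k]!≡n! n k k≤n = trans (cong (_* (k ! * (n ∸ k) !)) (nCk≡n!/k![n-k]! k≤n))
                                  (m/n*n≡m {{k !* (n ∸ k) !≢0}} (k![n∸k]!∣n! k≤n))

nC[k+1]*[k+1]≡nCk*[n∸k] : ∀ n k → k < n → (n C suc k) * suc k ≡ (n C k) * (n ∸ k)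
nC[k+1]*[k+1]≡nCk*[n∸k] n k k<n = *-cancelʳ-≡ _ _ (k ! * (n ∸ suc k) !) {{k !* (n ∸ suc k) !≢0}} (begin
    (n C suc k) * suc k * (k ! * (n ∸ suc k) !)
      ≡⟨ solve 4 (λ c a b d → c :* a :* (b :* d) := c :* (a :* b :* d)) refl (n C suc k) (suc k) (k !) ((n ∸ suc k) !) ⟩
    (n C suc k) * (suc k ! * (n ∸ suc k) !)         ≡⟨ nCk*k![n∸k]!≡n! n (suc k) k<n ⟩
    n !                                             ≡⟨ nCk*k![n∸k]!≡n! n k (<⇒≤ k<n) ⟨
    (n C k) * (k ! * (n ∸ k) !)                     ≡⟨ cong (λ j → (n C k) * (k ! * j !)) (+-∸-assoc 1 k<n) ⟩
    (n C k) * (k ! * (suc (n ∸ suc k) * (n ∸ suc k) !)) ≡⟨ cong (λ j → (n C k) * (k ! * (j * (n ∸ suc k) !))) (+-∸-assoc 1 k<n) ⟨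
    (n C k) * (k ! * ((n ∸ k) * (n ∸ suc k) !))
      ≡⟨ solve 4 (λ c a b d → c :* (a :* (b :* d)) := c :* b :* (a :* d)) refl (n C k) (k !) (n ∸ k) ((n ∸ suc k) !) ⟩
    (n C k) * (n ∸ k) * (k ! * (n ∸ suc k) !)       ∎)
  where open ≡-Reasoning

binomial-hockey-stick : ∀ r m → ∑[ p < suc r ] ((p + m) C m) ≡ (r + suc m) C suc m
binomial-hockey-stick zero m = trans (+-identityʳ _) (trans (nCn≡1 m) (sym (nCn≡1 (suc m))))
binomial-hockey-stick (suc r) m = begin
    ∑[ p < suc (suc r) ] ((p + m) C m)      ≡⟨ ∑<-suc (suc r) (λ p → (p + m) C m) ⟩
    ∑[ p < suc r ] ((p + m) C m) + (suc r + m) C m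
                                            ≡⟨ cong (_+ (suc r + m) C m) (binomial-hockey-stick r m) ⟩
    (r + suc m) C suc m + (suc r + m) C m   ≡⟨ cong (λ k → k C suc m + (suc r + m) C m) (+-suc r m) ⟩
    (suc r + m) C suc m + (suc r + m) C m   ≡⟨ +-comm ((suc r + m) C suc m) _ ⟩
    (suc r + m) C m + (suc r + m) C suc m   ≡⟨ nCk+nC[k+1]≡[n+1]C[k+1] (suc r + m) m ⟩
    suc (suc r + m) C suc m                 ≡⟨ cong (_C suc m) (+-suc (suc r) m) ⟨
    (suc r + suc m) C suc m                 ∎
  where open ≡-Reasoning

∑<-binomial : ∀ n → ∑[ i < suc n ] (n C i) ≡ 2 ^ n
∑<-binomial zero = refl
∑<-binomial (suc n) = begin
    1 + ∑[ i < suc n ] (suc n C suc i)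
      ≡⟨ cong (1 +_) (∑<-cong (suc n) (λ i → sym (nCk+nC[k+1]≡[n+1]C[k+1] n i))) ⟩
    1 + ∑[ i < suc n ] (n C i + n C suc i)
      ≡⟨ cong (1 +_) (∑<-+ (suc n) (n C_) (λ i → n C suc i)) ⟩
    1 + (S + ∑[ i < suc n ] (n C suc i))
      ≡⟨ cong (λ k → 1 + (S + k)) (∑<-suc n (λ i → n C suc i)) ⟩
    1 + (S + (∑[ i < n ] (n C suc i) + n C suc n))
      ≡⟨ cong (λ k → 1 + (S + (∑[ i < n ] (n C suc i) + k))) (k>n⇒nCk≡0 {n} {suc n} ≤-refl) ⟩
    1 + (S + (∑[ i < n ] (n C suc i) + 0))
      ≡⟨ solve 2 (λ s t → con 1 :+ (s :+ (t :+ con 0)) := s :+ ((con 1 :+ t) :+ con 0)) refl S (∑[ i < n ] (n C suc i)) ⟩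
    S + (S + 0)
      ≡⟨ cong (λ k → k + (k + 0)) (∑<-binomial n) ⟩
    2 ^ suc n ∎
  where
  open ≡-Reasoning
  S : ℕ
  S = ∑[ i < suc n ] (n C i)

-- Natural numbers in ℚ

ℕtoℚ-+ : ∀ a b → ℕtoℚ (a + b) ≡ ℕtoℚ a +ℚ ℕtoℚ b
ℕtoℚ-+ a b = ℚ.toℚᵘ-injective (begin
    toℚᵘ (ℕtoℚ (a + b))                      ≈⟨ ℚ.toℚᵘ-fromℚᵘ _ ⟩
    mkℚᵘ (ℤ.+ (a + b)) 0                      ≈⟨ *≡* sum-identity ⟩
    mkℚᵘ (ℤ.+ a) 0 ℚᵘ.+ mkℚᵘ (ℤ.+ b) 0
      ≈⟨ ℚᵘ.+-cong (ℚ.toℚᵘ-fromℚᵘ (mkℚᵘ (ℤ.+ a) 0)) (ℚ.toℚᵘ-fromℚᵘ (mkℚᵘ (ℤ.+ b) 0)) ⟨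
    toℚᵘ (ℕtoℚ a) ℚᵘ.+ toℚᵘ (ℕtoℚ b)          ≈⟨ ℚ.toℚᵘ-homo-+ (ℕtoℚ a) (ℕtoℚ b) ⟨
    toℚᵘ (ℕtoℚ a +ℚ ℕtoℚ b)                  ∎)
  where
  open ℚᵘ.≃-Reasoning
  sum-identity : ℤ.+ (a + b) ℤ.* ℤ.+ 1 ≡ (ℤ.+ a ℤ.* ℤ.+ 1 ℤ.+ ℤ.+ b ℤ.* ℤ.+ 1) ℤ.* ℤ.+ 1
  sum-identity = trans (ℤ.*-identityʳ _) (trans (ℤ.pos-+ a b) (sym (trans (ℤ.*-identityʳ _)
                   (cong₂ ℤ._+_ (ℤ.*-identityʳ (ℤ.+ a)) (ℤ.*-identityʳ (ℤ.+ b))))))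

ℕtoℚ-*-recip : ∀ c m .{{_ : NonZero m}} → ℕtoℚ (c * m) *ℚ recip m ≡ ℕtoℚ c
ℕtoℚ-*-recip c m@(suc j) = ℚ.toℚᵘ-injective (begin
    toℚᵘ (ℕtoℚ (c * m) *ℚ recip m)             ≈⟨ ℚ.toℚᵘ-homo-* (ℕtoℚ (c * m)) (recip m) ⟩
    toℚᵘ (ℕtoℚ (c * m)) ℚᵘ.* toℚᵘ (recip m)
      ≈⟨ ℚᵘ.*-cong (ℚ.toℚᵘ-fromℚᵘ (mkℚᵘ (ℤ.+ (c * m)) 0)) (ℚ.toℚᵘ-fromℚᵘ (mkℚᵘ (ℤ.+ 1) j)) ⟩
    mkℚᵘ (ℤ.+ (c * m)) 0 ℚᵘ.* mkℚᵘ (ℤ.+ 1) j   ≈⟨ *≡* quotient-identity ⟩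
    mkℚᵘ (ℤ.+ c) 0                             ≈⟨ ℚ.toℚᵘ-fromℚᵘ _ ⟨
    toℚᵘ (ℕtoℚ c)                              ∎)
  where
  open ℚᵘ.≃-Reasoning
  quotient-identity : ℤ.+ (c * m) ℤ.* ℤ.+ 1 ℤ.* ℤ.+ 1 ≡ ℤ.+ c ℤ.* ℤ.+ (1 * m)
  quotient-identity = trans (ℤ.*-identityʳ _) (trans (ℤ.*-identityʳ _)
                        (trans (ℤ.pos-* c m) (cong (λ k → ℤ.+ c ℤ.* ℤ.+ k) (sym (*-identityˡ m)))))

ℕtoℚ-*-sumFromToℚ-0 : ∀ N b (f : ℕ → ℚ) h → (∀ j → j ≤ b → ℕtoℚ N *ℚ f j ≡ ℕtoℚ (h j)) →
                      ℕtoℚ N *ℚ sumFromToℚ 0 b f ≡ ℕtoℚ (sumFromTo 0 b h)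
ℕtoℚ-*-sumFromToℚ-0 N zero f h term = begin
    ℕtoℚ N *ℚ (f 0 +ℚ 0ℚ)              ≡⟨ ℚ.*-distribˡ-+ (ℕtoℚ N) (f 0) 0ℚ ⟩
    ℕtoℚ N *ℚ f 0 +ℚ ℕtoℚ N *ℚ 0ℚ      ≡⟨ cong₂ _+ℚ_ (term 0 z≤n) (ℚ.*-zeroʳ (ℕtoℚ N)) ⟩
    ℕtoℚ (h 0) +ℚ ℕtoℚ 0              ≡⟨ ℕtoℚ-+ (h 0) 0 ⟨
    ℕtoℚ (h 0 + 0)                    ∎
  where open ≡-Reasoning
ℕtoℚ-*-sumFromToℚ-0 N (suc b) f h term = begin
    ℕtoℚ N *ℚ (f (suc b) +ℚ sumFromToℚ 0 b f)               ≡⟨ ℚ.*-distribˡ-+ (ℕtoℚ N) (f (suc b)) _ ⟩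
    ℕtoℚ N *ℚ f (suc b) +ℚ ℕtoℚ N *ℚ sumFromToℚ 0 b f
      ≡⟨ cong₂ _+ℚ_ (term (suc b) ≤-refl) (ℕtoℚ-*-sumFromToℚ-0 N b f h (λ j j≤b → term j (m≤n⇒m≤1+n j≤b))) ⟩
    ℕtoℚ (h (suc b)) +ℚ ℕtoℚ (sumFromTo 0 b h)              ≡⟨ ℕtoℚ-+ (h (suc b)) _ ⟨
    ℕtoℚ (h (suc b) + sumFromTo 0 b h)                      ∎
  where open ≡-Reasoning

ℕtoℚ-*-sumFromToℚ-1 : ∀ N b (f : ℕ → ℚ) h → (∀ j → 1 ≤ j → j ≤ b → ℕtoℚ N *ℚ f j ≡ ℕtoℚ (h j)) →
                      ℕtoℚ N *ℚ sumFromToℚ 1 b f ≡ ℕtoℚ (sumFromTo 1 b h)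
ℕtoℚ-*-sumFromToℚ-1 N zero f h term = ℚ.*-zeroʳ (ℕtoℚ N)
ℕtoℚ-*-sumFromToℚ-1 N (suc b) f h term = begin
    ℕtoℚ N *ℚ (f (suc b) +ℚ sumFromToℚ 1 b f)               ≡⟨ ℚ.*-distribˡ-+ (ℕtoℚ N) (f (suc b)) _ ⟩
    ℕtoℚ N *ℚ f (suc b) +ℚ ℕtoℚ N *ℚ sumFromToℚ 1 b f
      ≡⟨ cong₂ _+ℚ_ (term (suc b) (s≤s z≤n) ≤-refl)
                    (ℕtoℚ-*-sumFromToℚ-1 N b f h (λ j 1≤j j≤b → term j 1≤j (m≤n⇒m≤1+n j≤b))) ⟩
    ℕtoℚ (h (suc b)) +ℚ ℕtoℚ (sumFromTo 1 b h)              ≡⟨ ℕtoℚ-+ (h (suc b)) _ ⟨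
    ℕtoℚ (h (suc b) + sumFromTo 1 b h)                      ∎
  where open ≡-Reasoning

arrangements : ℕ → ℕ
arrangements n = ∑[ k < suc n ] ((n C k) * k !)

arrangements-reversed : ∀ n → arrangements n ≡ sumFromTo 0 n (λ j → rising j (n ∸ j))
arrangements-reversed n = begin
    arrangements n                                 ≡⟨ ∑<-reverse (suc n) (λ k → (n C k) * k !) ⟩
    ∑[ i < suc n ] ((n C (n ∸ i)) * (n ∸ i) !)     ≡⟨ ∑<-cong< (suc n) (λ i i≤n → term i (≤-pred i≤n)) ⟩
    ∑[ i < suc n ] rising i (n ∸ i)                ≡⟨ sumFromTo-0 n (λ j → rising j (n ∸ j)) ⟨
    sumFromTo 0 n (λ j → rising j (n ∸ j))         ∎
  where
  open ≡-Reasoning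
  term : ∀ i → i ≤ n → (n C (n ∸ i)) * (n ∸ i) ! ≡ rising i (n ∸ i)
  term i i≤n = *-cancelʳ-≡ _ _ (i !) {{i !≢0}} (begin
      (n C (n ∸ i)) * (n ∸ i) ! * i !                  ≡⟨ *-assoc (n C (n ∸ i)) _ _ ⟩
      (n C (n ∸ i)) * ((n ∸ i) ! * i !)                ≡⟨ cong (λ k → (n C (n ∸ i)) * ((n ∸ i) ! * k !)) (m∸[m∸n]≡n i≤n) ⟨
      (n C (n ∸ i)) * ((n ∸ i) ! * (n ∸ (n ∸ i)) !)    ≡⟨ nCk*k![n∸k]!≡n! n (n ∸ i) (m∸n≤m n i) ⟩
      n !                                              ≡⟨ cong _! (m+[n∸m]≡n i≤n) ⟨
      (i + (n ∸ i)) !                                  ≡⟨ !*rising i (n ∸ i) ⟨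
      i ! * rising i (n ∸ i)                           ≡⟨ *-comm (i !) _ ⟩
      rising i (n ∸ i) * i !                           ∎)

ℕtoℚ-arrangements : ∀ n → ℕtoℚ (arrangements n) ≡ ℕtoℚ (n !) *ℚ sumFromToℚ 0 n (λ j → recip (j !))
ℕtoℚ-arrangements n = trans (cong ℕtoℚ (arrangements-reversed n))
  (sym (ℕtoℚ-*-sumFromToℚ-0 (n !) n (λ j → recip (j !)) (λ j → rising j (n ∸ j)) term))
  where
  term : ∀ j → j ≤ n → ℕtoℚ (n !) *ℚ recip (j !) ≡ ℕtoℚ (rising j (n ∸ j))
  term j j≤n = trans (cong (λ k → ℕtoℚ k *ℚ recip (j !)) n!≡)
                     (ℕtoℚ-*-recip (rising j (n ∸ j)) (j !) {{j !≢0}})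
    where
    n!≡ : n ! ≡ rising j (n ∸ j) * j !
    n!≡ = sym (trans (*-comm (rising j (n ∸ j)) (j !)) (trans (!*rising j (n ∸ j)) (cong _! (m+[n∸m]≡n j≤n))))

-- The ten pattern classes

-- The length of the initial run of barred letters.
runLength : Bool → ℕ → ℕ
runLength false _ = 0
runLength true r = suc r

-- allBarred r: every letter is barred, and there are r of them;
-- mixed r: some letter is unbarred, and the word starts with r barred letters.
module BarredRun where

  data State : Set where
    allBarred mixed : ℕ → State

  next : Bool → State → State
  next false _ = mixed 0
  next true (allBarred r) = allBarred (suc r)
  next true (mixed r) = mixed (suc r)

  isAllBarred : State → Bool
  isAllBarred (allBarred _) = true
  isAllBarred (mixed _) = false

-- sorted r: the word is r barred letters followed by unbarred ones only;
-- unsorted r: otherwise, and the word starts with r barred letters.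
module SortedBars where

  data State : Set where
    sorted unsorted : ℕ → State

  next : Bool → State → State
  next false (sorted zero) = sorted 0
  next false (sorted (suc _)) = unsorted 0
  next false (unsorted _) = unsorted 0
  next true (sorted r) = sorted (suc r)
  next true (unsorted r) = unsorted (suc r)

  isAllUnbarred : State → Bool
  isAllUnbarred (sorted zero) = true
  isAllUnbarred (sorted (suc _)) = false
  isAllUnbarred (unsorted _) = false

module Class₁ where

  open Insertion ((u 1 , u 2) ∷ (u 1 , o 2) ∷ (o 1 , u 2) ∷ [])

  precedesAll : Bool → ℕ → Bool
  precedesAll _ _ = true

  precedesAll-start : ∀ b → precedesAll b 0 ≡ true
  precedesAll-start _ = refl

  precedesAll-next : ∀ b c r → precedesAll b (runLength c r) ≡ mayPrecede b c ∧ precedesAll b r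
  precedesAll-next false false r = refl
  precedesAll-next false true r = refl
  precedesAll-next true false r = refl
  precedesAll-next true true r = refl

  -- An unbarred maximum can only go first, a barred one anywhere in the initial barred run.
  weight : Bool → (ℕ → ℕ) → ℕ → ℕ
  weight false g r = g 0
  weight true g r = suc r * g (suc r)

  weight-next : ∀ b c g r → weight b g (runLength c r) ≡
    (if precedesAll b (runLength c r) then g (runLength b (runLength c r)) else 0) + (if mayFollow b c then weight b (g ∘ runLength c) r else 0)
  weight-next false false g r = sym (+-identityʳ _)
  weight-next false true g r = sym (+-identityʳ _)
  weight-next true false g r = refl
  weight-next true true g r = refl

  weight-start : ∀ b g → weight b g 0 ≡ g (runLength b 0)
  weight-start false g = refl
  weight-start true g = +-identityʳ _

  open Transfer 0 runLength precedesAll weight precedesAll-start precedesAll-next weight-start weight-next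

  compFactSum-0 : ∀ d → compFactSum d 0 ≡ 1
  compFactSum-0 zero = refl
  compFactSum-0 (suc d) = trans (+-identityʳ _) (trans (+-identityʳ _) (compFactSum-0 d))

  risingCompSum : ℕ → ℕ → ℕ → ℕ
  risingCompSum r d t = ∑[ i < suc t ] (rising r i * compFactSum d (t ∸ i))

  compFactSum-suc : ∀ d t → compFactSum (suc d) t ≡ risingCompSum 0 d t
  compFactSum-suc d t = trans (sumFromTo-0 t (λ i → i ! * compFactSum d (t ∸ i)))
    (∑<-cong (suc t) (λ i → cong (_* compFactSum d (t ∸ i)) (sym (rising-0 i))))

  risingCompSum-0 : ∀ r d → risingCompSum r d 0 ≡ 1
  risingCompSum-0 r d = trans (+-identityʳ _) (trans (+-identityʳ _) (compFactSum-0 d))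

  risingCompSum-suc : ∀ r d t → risingCompSum r d (suc t) ≡ compFactSum d (suc t) + suc r * risingCompSum (suc r) d t
  risingCompSum-suc r d t = cong₂ _+_ (+-identityʳ (compFactSum d (suc t)))
    (trans (∑<-cong (suc t) (λ i → *-assoc (suc r) (rising (suc r) i) (compFactSum d (t ∸ i))))
           (∑<-* (suc t) (suc r) (λ i → rising (suc r) i * compFactSum d (t ∸ i))))

  closedForm : ℕ → ℕ → ℕ
  closedForm r m = ∑[ d < suc m ] risingCompSum r d (m ∸ d)

  closedForm-suc : ∀ r m → closedForm r (suc m) ≡ closedForm 0 m + suc r * closedForm (suc r) m
  closedForm-suc r m = begin
      ∑[ d < suc (suc m) ] risingCompSum r d (suc m ∸ d)
        ≡⟨ ∑<-suc (suc m) (λ d → risingCompSum r d (suc m ∸ d)) ⟩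
      ∑[ d < suc m ] risingCompSum r d (suc m ∸ d) + risingCompSum r (suc m) (suc m ∸ suc m)
        ≡⟨ cong₂ _+_ (∑<-cong< (suc m) (λ d d≤m → trans (cong (risingCompSum r d) (+-∸-assoc 1 (≤-pred d≤m)))
                                                     (risingCompSum-suc r d (m ∸ d))))
                     (trans (cong (risingCompSum r (suc m)) (n∸n≡0 m)) (risingCompSum-0 r (suc m))) ⟩
      ∑[ d < suc m ] (compFactSum d (suc (m ∸ d)) + suc r * risingCompSum (suc r) d (m ∸ d)) + 1
        ≡⟨ cong (_+ 1) (∑<-+ (suc m) (λ d → compFactSum d (suc (m ∸ d))) (λ d → suc r * risingCompSum (suc r) d (m ∸ d))) ⟩
      (S + ∑[ d < suc m ] (suc r * risingCompSum (suc r) d (m ∸ d))) + 1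
        ≡⟨ cong (λ z → (S + z) + 1) (∑<-* (suc m) (suc r) (λ d → risingCompSum (suc r) d (m ∸ d))) ⟩
      (S + suc r * closedForm (suc r) m) + 1
        ≡⟨ solve 3 (λ a b c → (a :+ b :* c) :+ con 1 := (a :+ con 1) :+ b :* c) refl S (suc r) (closedForm (suc r) m) ⟩
      (S + 1) + suc r * closedForm (suc r) m
        ≡⟨ cong (_+ suc r * closedForm (suc r) m) S+1≡ ⟩
      closedForm 0 m + suc r * closedForm (suc r) m ∎
    where
    open ≡-Reasoning
    S : ℕ
    S = ∑[ d < suc m ] compFactSum d (suc (m ∸ d))
    S+1≡ : S + 1 ≡ closedForm 0 m
    S+1≡ = begin
        ∑[ d < m ] compFactSum (suc d) (suc (m ∸ suc d)) + 1
          ≡⟨ cong (_+ 1) (∑<-cong< m (λ d d<m → cong (compFactSum (suc d)) (sym (+-∸-assoc 1 d<m)))) ⟩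
        ∑[ d < m ] compFactSum (suc d) (m ∸ d) + 1
          ≡⟨ cong (λ k → ∑[ d < m ] compFactSum (suc d) (m ∸ d) + k)
                  (sym (trans (cong (compFactSum (suc m)) (n∸n≡0 m)) (compFactSum-0 (suc m)))) ⟩
        ∑[ d < m ] compFactSum (suc d) (m ∸ d) + compFactSum (suc m) (m ∸ m)
          ≡⟨ ∑<-suc m (λ d → compFactSum (suc d) (m ∸ d)) ⟨
        ∑[ d < suc m ] compFactSum (suc d) (m ∸ d)
          ≡⟨ ∑<-cong (suc m) (λ d → compFactSum-suc d (m ∸ d)) ⟩
        closedForm 0 m ∎

  count≡closedForm : ∀ m r → count r m ≡ closedForm r m
  count≡closedForm zero r = refl
  count≡closedForm (suc m) r =
    trans (cong₂ (λ a b → a + suc r * b) (count≡closedForm m 0) (count≡closedForm m (suc r))) (sym (closedForm-suc r m))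

  count-T₁ : ∀ n → bCard n T₁ (sumFromTo 0 n (λ d → compFactSum (suc d) (n ∸ d)))
  count-T₁ n = subst (bCard n T₁) count≡ (bCard-count n)
    where
    count≡ : count 0 n ≡ sumFromTo 0 n (λ d → compFactSum (suc d) (n ∸ d))
    count≡ = trans (count≡closedForm n 0)
      (trans (∑<-cong (suc n) (λ d → sym (compFactSum-suc d (n ∸ d)))) (sym (sumFromTo-0 n _)))

module Class₂ where

  open Insertion ((u 1 , u 2) ∷ (u 1 , o 2) ∷ (o 1 , o 2) ∷ [])

  precedesAll : Bool → ℕ → Bool
  precedesAll _ _ = true

  precedesAll-start : ∀ b → precedesAll b 0 ≡ true
  precedesAll-start _ = refl

  precedesAll-next : ∀ b c r → precedesAll b (runLength c r) ≡ mayPrecede b c ∧ precedesAll b r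
  precedesAll-next false false r = refl
  precedesAll-next false true r = refl
  precedesAll-next true false r = refl
  precedesAll-next true true r = refl

  -- A barred maximum can only go first, an unbarred one anywhere in the initial barred run.
  weight : Bool → (ℕ → ℕ) → ℕ → ℕ
  weight false g r = ∑< (suc r) g
  weight true g r = g (suc r)

  weight-next : ∀ b c g r → weight b g (runLength c r) ≡
    (if precedesAll b (runLength c r) then g (runLength b (runLength c r)) else 0) + (if mayFollow b c then weight b (g ∘ runLength c) r else 0)
  weight-next false false g r = refl
  weight-next false true g r = refl
  weight-next true false g r = sym (+-identityʳ _)
  weight-next true true g r = sym (+-identityʳ _)

  weight-start : ∀ b g → weight b g 0 ≡ g (runLength b 0)
  weight-start false g = +-identityʳ _
  weight-start true g = refl

  open Transfer 0 runLength precedesAll weight precedesAll-start precedesAll-next weight-start weight-next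

  count-suc : ∀ r m → count (suc r) (suc m) ≡ count r (suc m) + count (suc (suc r)) m
  count-suc r m = cong (_+ count (suc (suc r)) m) (∑<-suc (suc r) (λ p → count p m))

  -- Reflection principle: count r m = paths r m − badPaths r m, stated additively.
  N : ℕ → ℕ → ℕ
  N r m = suc (r + 2 * m)

  paths badPaths : ℕ → ℕ → ℕ
  paths r m = N r m C m
  badPaths r zero = 0
  badPaths r (suc m) = N r (suc m) C m

  N-suc : ∀ r m → N r (suc m) ≡ N (suc (suc r)) m
  N-suc r m = cong suc (solve 2 (λ r m → r :+ con 2 :* (con 1 :+ m) := con 2 :+ r :+ con 2 :* m) refl r m)

  pascal : ∀ n k → n C k + n C suc k ≡ suc n C suc k
  pascal = nCk+nC[k+1]≡[n+1]C[k+1]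

  badPaths-suc : ∀ r m → badPaths (suc r) (suc m) ≡ badPaths r (suc m) + badPaths (suc (suc r)) m
  badPaths-suc r zero = refl
  badPaths-suc r (suc k) = begin
      suc (N r (suc (suc k))) C suc k
        ≡⟨ pascal (N r (suc (suc k))) k ⟨
      N r (suc (suc k)) C k + N r (suc (suc k)) C suc k
        ≡⟨ cong (λ n → n C k + N r (suc (suc k)) C suc k) (N-suc r (suc k)) ⟩
      N (suc (suc r)) (suc k) C k + N r (suc (suc k)) C suc k
        ≡⟨ +-comm (N (suc (suc r)) (suc k) C k) _ ⟩
      badPaths r (suc (suc k)) + badPaths (suc (suc r)) (suc k) ∎
    where open ≡-Reasoning

  reflection-suc : ∀ m → (∀ r → count r m + badPaths r m ≡ paths r m) →
                   ∀ r → count r (suc m) + badPaths r (suc m) ≡ paths r (suc m)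
  reflection-suc m ih (suc r) = begin
      count (suc r) (suc m) + badPaths (suc r) (suc m)
        ≡⟨ cong₂ _+_ (count-suc r m) (badPaths-suc r m) ⟩
      (count r (suc m) + count (suc (suc r)) m) + (badPaths r (suc m) + badPaths (suc (suc r)) m)
        ≡⟨ solve 4 (λ a b c d → (a :+ b) :+ (c :+ d) := (a :+ c) :+ (b :+ d)) refl
                 (count r (suc m)) (count (suc (suc r)) m) (badPaths r (suc m)) (badPaths (suc (suc r)) m) ⟩
      (count r (suc m) + badPaths r (suc m)) + (count (suc (suc r)) m + badPaths (suc (suc r)) m)
        ≡⟨ cong₂ _+_ (reflection-suc m ih r) (ih (suc (suc r))) ⟩
      N r (suc m) C suc m + N (suc (suc r)) m C m
        ≡⟨ cong (λ n → N r (suc m) C suc m + n C m) (N-suc r m) ⟨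
      N r (suc m) C suc m + N r (suc m) C m
        ≡⟨ +-comm (N r (suc m) C suc m) _ ⟩
      N r (suc m) C m + N r (suc m) C suc m
        ≡⟨ pascal (N r (suc m)) m ⟩
      paths (suc r) (suc m) ∎
    where open ≡-Reasoning
  reflection-suc zero ih zero = refl
  reflection-suc (suc k) ih zero = begin
      ((count 0 (suc k) + 0) + count 1 (suc k)) + badPaths 0 (suc (suc k))
        ≡⟨ cong (λ z → (z + count 1 (suc k)) + badPaths 0 (suc (suc k))) (+-identityʳ (count 0 (suc k))) ⟩
      (c₀ + c₁) + badPaths 0 (suc (suc k))
        ≡⟨ cong ((c₀ + c₁) +_) badPaths≡ ⟩
      (c₀ + c₁) + (x + (a + b))
        ≡⟨ solve 5 (λ c₀ c₁ x a b → (c₀ :+ c₁) :+ (x :+ (a :+ b)) := ((c₀ :+ a) :+ (c₁ :+ x)) :+ b) refl c₀ c₁ x a b ⟩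
      ((c₀ + a) + (c₁ + x)) + b
        ≡⟨ cong₂ (λ p q → (p + q) + b) (ih 0) (trans (ih 1) (sym (pascal M k))) ⟩
      (b + (a + b)) + b
        ≡⟨ solve 2 (λ a b → (b :+ (a :+ b)) :+ b := (a :+ b) :+ (b :+ b)) refl a b ⟩
      (a + b) + (b + b)
        ≡⟨ cong (λ z → (a + b) + (b + z)) b≡c ⟩
      (a + b) + (b + c)
        ≡⟨ cong₂ _+_ (pascal M k) (pascal M (suc k)) ⟩
      suc M C suc k + suc M C suc (suc k)
        ≡⟨ pascal (suc M) (suc k) ⟩
      suc (suc M) C suc (suc k)
        ≡⟨ cong (_C suc (suc k)) N₀ ⟨
      paths 0 (suc (suc k)) ∎
    where
    open ≡-Reasoning
    M c₀ c₁ a b c x : ℕ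
    M = N 0 (suc k)
    c₀ = count 0 (suc k)
    c₁ = count 1 (suc k)
    a = M C k
    b = M C suc k
    c = M C suc (suc k)
    x = suc M C k
    N₀ : N 0 (suc (suc k)) ≡ suc (suc M)
    N₀ = cong suc (solve 1 (λ k → con 2 :* (con 2 :+ k) := con 2 :+ con 2 :* (con 1 :+ k)) refl k)
    badPaths≡ : badPaths 0 (suc (suc k)) ≡ x + (a + b)
    badPaths≡ = begin
        N 0 (suc (suc k)) C suc k ≡⟨ cong (_C suc k) N₀ ⟩
        suc (suc M) C suc k       ≡⟨ pascal (suc M) k ⟨
        x + suc M C suc k         ≡⟨ cong (x +_) (pascal M k) ⟨
        x + (a + b)               ∎
    M≡ : M ≡ suc (suc k) + suc k
    M≡ = solve 1 (λ k → con 1 :+ con 2 :* (con 1 :+ k) := (con 2 :+ k) :+ (con 1 :+ k)) refl k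
    b≡c : b ≡ c
    b≡c = trans (nCk≡nC[n∸k] (subst (suc k ≤_) (sym M≡) (m≤n+m (suc k) (suc (suc k)))))
                (cong (M C_) (trans (cong (_∸ suc k) M≡) (m+n∸n≡m (suc (suc k)) (suc k))))

  reflection : ∀ m r → count r m + badPaths r m ≡ paths r m
  reflection zero r = refl
  reflection (suc m) r = reflection-suc m (reflection m) r

  count₀*[n+2] : ∀ n → count 0 n * suc (suc n) ≡ paths 0 n + paths 0 n
  count₀*[n+2] zero = refl
  count₀*[n+2] (suc k) = +-cancelʳ-≡ (P * suc k) _ _ (begin
      c₀ * (3 + k) + P * suc k   ≡⟨ cong (c₀ * (3 + k) +_) ratio ⟨
      c₀ * (3 + k) + B * (3 + k) ≡⟨ *-distribʳ-+ (3 + k) c₀ B ⟨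
      (c₀ + B) * (3 + k)         ≡⟨ cong (_* (3 + k)) (reflection (suc k) 0) ⟩
      P * (3 + k)                ≡⟨ solve 2 (λ p k → p :* (con 3 :+ k) := (p :+ p) :+ p :* (con 1 :+ k)) refl P k ⟩
      (P + P) + P * suc k        ∎)
    where
    open ≡-Reasoning
    M c₀ B P : ℕ
    M = N 0 (suc k)
    c₀ = count 0 (suc k)
    B = badPaths 0 (suc k)
    P = paths 0 (suc k)
    M≡ : M ≡ suc (suc (suc k)) + k
    M≡ = solve 1 (λ k → con 1 :+ con 2 :* (con 1 :+ k) := (con 3 :+ k) :+ k) refl k
    ratio : B * (3 + k) ≡ P * suc k
    ratio = sym (trans (nC[k+1]*[k+1]≡nCk*[n∸k] M k (subst (k <_) (sym M≡) (s≤s (m≤n+m k (suc (suc k))))))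
                       (cong ((M C k) *_) (trans (cong (_∸ k) M≡) (m+n∸n≡m (suc (suc (suc k))) k))))

  catalan≡count₀ : ∀ n → catalan (suc n) ≡ count 0 n
  catalan≡count₀ n = begin
      ((2 * suc n) C suc n) / suc (suc n)        ≡⟨ /-congˡ central ⟩
      (count 0 n * suc (suc n)) / suc (suc n)    ≡⟨ m*n/n≡m (count 0 n) (suc (suc n)) ⟩
      count 0 n ∎
    where
    open ≡-Reasoning
    N≡ : N 0 n ≡ suc n + n
    N≡ = solve 1 (λ n → con 1 :+ con 2 :* n := (con 1 :+ n) :+ n) refl n
    symmetric : N 0 n C suc n ≡ N 0 n C n
    symmetric = sym (trans (nCk≡nC[n∸k] (subst (n ≤_) (sym N≡) (≤-trans (m≤n+m n n) (n≤1+n _))))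
                           (cong (N 0 n C_) (trans (cong (_∸ n) N≡) (m+n∸n≡m (suc n) n))))
    central : (2 * suc n) C suc n ≡ count 0 n * suc (suc n)
    central = begin
        (2 * suc n) C suc n         ≡⟨ cong (_C suc n) (solve 1 (λ n → con 2 :* (con 1 :+ n) := con 2 :+ con 2 :* n) refl n) ⟩
        suc (N 0 n) C suc n         ≡⟨ pascal (N 0 n) n ⟨
        N 0 n C n + N 0 n C suc n   ≡⟨ cong (N 0 n C n +_) symmetric ⟩
        paths 0 n + paths 0 n       ≡⟨ count₀*[n+2] n ⟨
        count 0 n * suc (suc n)     ∎

  count-T₂ : ∀ n → bCard n T₂ (catalan (suc n))
  count-T₂ n = subst (bCard n T₂) (sym (catalan≡count₀ n)) (bCard-count n)

module Class₃ where

  open BarredRun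
  open Insertion ((u 1 , u 2) ∷ (u 1 , o 2) ∷ (u 2 , u 1) ∷ [])

  precedesAll : Bool → State → Bool
  precedesAll false = isAllBarred
  precedesAll true _ = true

  -- Every new maximum goes into the initial run of barred letters, an unbarred one
  -- only if all letters are barred.
  weight : Bool → (State → ℕ) → State → ℕ
  weight false g (allBarred r) = ∑[ p < suc r ] g (mixed p)
  weight false g (mixed _) = 0
  weight true g (allBarred r) = suc r * g (allBarred (suc r))
  weight true g (mixed r) = suc r * g (mixed (suc r))

  precedesAll-start : ∀ b → precedesAll b (allBarred 0) ≡ true
  precedesAll-start false = refl
  precedesAll-start true = refl

  precedesAll-next : ∀ b c σ → precedesAll b (next c σ) ≡ mayPrecede b c ∧ precedesAll b σ
  precedesAll-next false false σ = refl
  precedesAll-next false true (allBarred _) = refl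
  precedesAll-next false true (mixed _) = refl
  precedesAll-next true c σ = refl

  weight-next : ∀ b c g σ → weight b g (next c σ) ≡
    (if precedesAll b (next c σ) then g (next b (next c σ)) else 0) + (if mayFollow b c then weight b (g ∘ next c) σ else 0)
  weight-next false false g σ = refl
  weight-next false true g (allBarred r) = refl
  weight-next false true g (mixed r) = refl
  weight-next true false g σ = refl
  weight-next true true g (allBarred r) = refl
  weight-next true true g (mixed r) = refl

  weight-start : ∀ b g → weight b g (allBarred 0) ≡ g (next b (allBarred 0))
  weight-start false g = +-identityʳ _
  weight-start true g = +-identityʳ _

  open Transfer (allBarred 0) next precedesAll weight precedesAll-start precedesAll-next weight-start weight-next

  count-mixed : ∀ m r → count (mixed r) m ≡ rising r m
  count-mixed zero r = refl
  count-mixed (suc m) r = cong (suc r *_) (count-mixed m (suc r))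

  -- The divisions are exact, as i + 1 ≤ L + m.
  count-allBarred : ∀ m L → L ! * count (allBarred L) m ≡ (L + m) ! + ∑[ i < m ] ((L + m) ! / suc i)
  count-allBarred zero L = trans (*-identityʳ _) (trans (cong _! (sym (+-identityʳ L))) (sym (+-identityʳ _)))
  count-allBarred (suc m) L = begin
      L ! * (∑[ p < suc L ] count (mixed p) m + suc L * count (allBarred (suc L)) m)
        ≡⟨ *-distribˡ-+ (L !) _ _ ⟩
      L ! * ∑[ p < suc L ] count (mixed p) m + L ! * (suc L * count (allBarred (suc L)) m)
        ≡⟨ cong₂ _+_ mixed-part (trans (sym (*-assoc (L !) (suc L) _)) (cong (_* count (allBarred (suc L)) m) (*-comm (L !) (suc L)))) ⟩
      K ! / suc m + suc L ! * count (allBarred (suc L)) m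
        ≡⟨ cong (K ! / suc m +_) (count-allBarred m (suc L)) ⟩
      K ! / suc m + ((suc L + m) ! + ∑[ i < m ] ((suc L + m) ! / suc i))
        ≡⟨ cong (λ k → K ! / suc m + (k ! + ∑[ i < m ] (k ! / suc i))) (+-suc L m) ⟨
      K ! / suc m + (K ! + ∑[ i < m ] (K ! / suc i))
        ≡⟨ solve 3 (λ a b c → a :+ (b :+ c) := b :+ (c :+ a)) refl (K ! / suc m) (K !) (∑[ i < m ] (K ! / suc i)) ⟩
      K ! + (∑[ i < m ] (K ! / suc i) + K ! / suc m)
        ≡⟨ cong (K ! +_) (∑<-suc m (λ i → K ! / suc i)) ⟨
      K ! + ∑[ i < suc m ] (K ! / suc i) ∎
    where
    open ≡-Reasoning
    K : ℕ
    K = L + suc m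
    mixed-part : L ! * ∑[ p < suc L ] count (mixed p) m ≡ K ! / suc m
    mixed-part = *-cancelʳ-≡ _ _ (suc m) (begin
        L ! * ∑[ p < suc L ] count (mixed p) m * suc m
          ≡⟨ cong (λ s → L ! * s * suc m) (∑<-cong (suc L) (λ p → count-mixed m p)) ⟩
        L ! * ∑[ p < suc L ] rising p m * suc m
          ≡⟨ *-assoc (L !) _ (suc m) ⟩
        L ! * (∑[ p < suc L ] rising p m * suc m)
          ≡⟨ cong (L ! *_) (trans (*-comm _ (suc m)) (rising-hockey-stick L m)) ⟩
        L ! * rising L (suc m)
          ≡⟨ !*rising L (suc m) ⟩
        K !
          ≡⟨ n!/[j+1]*[j+1]≡n! K m (m≤n+m (suc m) L) ⟨
        K ! / suc m * suc m ∎)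

  count-T₃ : ∀ n → ∃ λ k → bCard n T₃ k × ℕtoℚ k ≡ ℕtoℚ (n !) +ℚ ℕtoℚ (n !) *ℚ sumFromToℚ 1 n recip
  count-T₃ n = count (allBarred 0) n , bCard-count n , value
    where
    open ≡-Reasoning
    h : ℕ → ℕ
    h zero = 0
    h (suc j) = n ! / suc j
    count≡ : count (allBarred 0) n ≡ n ! + sumFromTo 1 n h
    count≡ = trans (sym (+-identityʳ _)) (trans (count-allBarred n 0) (cong (n ! +_) (sym (sumFromTo-1 n h))))
    term : ∀ j → 1 ≤ j → j ≤ n → ℕtoℚ (n !) *ℚ recip j ≡ ℕtoℚ (h j)
    term (suc j) _ j<n = trans (cong (λ k → ℕtoℚ k *ℚ recip (suc j)) (sym (n!/[j+1]*[j+1]≡n! n j j<n)))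
                               (ℕtoℚ-*-recip (h (suc j)) (suc j))
    value : ℕtoℚ (count (allBarred 0) n) ≡ ℕtoℚ (n !) +ℚ ℕtoℚ (n !) *ℚ sumFromToℚ 1 n recip
    value = begin
      ℕtoℚ (count (allBarred 0) n)                          ≡⟨ cong ℕtoℚ count≡ ⟩
      ℕtoℚ (n ! + sumFromTo 1 n h)                          ≡⟨ ℕtoℚ-+ (n !) _ ⟩
      ℕtoℚ (n !) +ℚ ℕtoℚ (sumFromTo 1 n h)
        ≡⟨ cong (ℕtoℚ (n !) +ℚ_) (ℕtoℚ-*-sumFromToℚ-1 (n !) n recip h term) ⟨
      ℕtoℚ (n !) +ℚ ℕtoℚ (n !) *ℚ sumFromToℚ 1 n recip      ∎

module Class₄ where

  open SortedBars
  open Insertion ((u 1 , u 2) ∷ (u 1 , o 2) ∷ (u 2 , o 1) ∷ [])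

  precedesAll : Bool → State → Bool
  precedesAll false = isAllUnbarred
  precedesAll true _ = true

  -- Every new maximum goes into the initial run of barred letters; an unbarred one only
  -- at its end, and only if no barred letter comes later.
  weight : Bool → (State → ℕ) → State → ℕ
  weight false g (sorted r) = g (sorted r)
  weight false g (unsorted _) = 0
  weight true g (sorted r) = suc r * g (sorted (suc r))
  weight true g (unsorted r) = suc r * g (unsorted (suc r))

  precedesAll-start : ∀ b → precedesAll b (sorted 0) ≡ true
  precedesAll-start false = refl
  precedesAll-start true = refl

  precedesAll-next : ∀ b c σ → precedesAll b (next c σ) ≡ mayPrecede b c ∧ precedesAll b σ
  precedesAll-next false false (sorted zero) = refl
  precedesAll-next false false (sorted (suc _)) = refl
  precedesAll-next false false (unsorted _) = refl
  precedesAll-next false true (sorted _) = refl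
  precedesAll-next false true (unsorted _) = refl
  precedesAll-next true c σ = refl

  weight-next : ∀ b c g σ → weight b g (next c σ) ≡
    (if precedesAll b (next c σ) then g (next b (next c σ)) else 0) + (if mayFollow b c then weight b (g ∘ next c) σ else 0)
  weight-next false false g (sorted zero) = sym (+-identityʳ _)
  weight-next false false g (sorted (suc _)) = refl
  weight-next false false g (unsorted _) = refl
  weight-next false true g (sorted _) = refl
  weight-next false true g (unsorted _) = refl
  weight-next true false g (sorted zero) = refl
  weight-next true false g (sorted (suc _)) = refl
  weight-next true false g (unsorted _) = refl
  weight-next true true g (sorted _) = refl
  weight-next true true g (unsorted _) = refl

  weight-start : ∀ b g → weight b g (sorted 0) ≡ g (next b (sorted 0))
  weight-start false g = refl
  weight-start true g = +-identityʳ _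

  open Transfer (sorted 0) next precedesAll weight precedesAll-start precedesAll-next weight-start weight-next

  binomialRising : ℕ → ℕ → ℕ
  binomialRising r m = ∑[ k < suc m ] ((m C k) * rising r k)

  binomialRising-suc : ∀ r m → binomialRising r (suc m) ≡ binomialRising r m + suc r * binomialRising (suc r) m
  binomialRising-suc r m = sym (begin
      ∑[ k < suc m ] ((m C k) * rising r k) + suc r * ∑[ k < suc m ] ((m C k) * rising (suc r) k)
        ≡⟨ cong₂ _+_ peel-first (∑<-* (suc m) (suc r) (λ k → (m C k) * rising (suc r) k)) ⟨
      (1 + ∑[ k < suc m ] ((m C suc k) * rising r (suc k))) + ∑[ k < suc m ] (suc r * ((m C k) * rising (suc r) k))
        ≡⟨ +-assoc 1 (∑[ k < suc m ] ((m C suc k) * rising r (suc k))) _ ⟩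
      1 + (∑[ k < suc m ] ((m C suc k) * rising r (suc k)) + ∑[ k < suc m ] (suc r * ((m C k) * rising (suc r) k)))
        ≡⟨ cong (1 +_) (∑<-+ (suc m) (λ k → (m C suc k) * rising r (suc k)) (λ k → suc r * ((m C k) * rising (suc r) k))) ⟨
      1 + ∑[ k < suc m ] ((m C suc k) * rising r (suc k) + suc r * ((m C k) * rising (suc r) k))
        ≡⟨ cong (1 +_) (∑<-cong (suc m) pascal-term) ⟩
      binomialRising r (suc m) ∎)
    where
    open ≡-Reasoning
    peel-first : 1 + ∑[ k < suc m ] ((m C suc k) * rising r (suc k)) ≡ binomialRising r m
    peel-first = begin
        1 + ∑[ k < suc m ] ((m C suc k) * rising r (suc k))
          ≡⟨ cong (1 +_) (∑<-suc m (λ k → (m C suc k) * rising r (suc k))) ⟩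
        1 + (∑[ k < m ] ((m C suc k) * rising r (suc k)) + (m C suc m) * rising r (suc m))
          ≡⟨ cong (λ c → 1 + (∑[ k < m ] ((m C suc k) * rising r (suc k)) + c * rising r (suc m))) (k>n⇒nCk≡0 {m} {suc m} ≤-refl) ⟩
        1 + (∑[ k < m ] ((m C suc k) * rising r (suc k)) + 0)
          ≡⟨ cong (1 +_) (+-identityʳ _) ⟩
        binomialRising r m ∎
    pascal-term : ∀ k → (m C suc k) * rising r (suc k) + suc r * ((m C k) * rising (suc r) k) ≡ (suc m C suc k) * rising r (suc k)
    pascal-term k = begin
        (m C suc k) * rising r (suc k) + suc r * ((m C k) * rising (suc r) k)
          ≡⟨ cong ((m C suc k) * rising r (suc k) +_)
                  (solve 3 (λ a b c → a :* (b :* c) := b :* (a :* c)) refl (suc r) (m C k) (rising (suc r) k)) ⟩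
        (m C suc k) * rising r (suc k) + (m C k) * rising r (suc k)
          ≡⟨ *-distribʳ-+ (rising r (suc k)) (m C suc k) (m C k) ⟨
        ((m C suc k) + (m C k)) * rising r (suc k)
          ≡⟨ cong (_* rising r (suc k)) (trans (+-comm (m C suc k) (m C k)) (nCk+nC[k+1]≡[n+1]C[k+1] m k)) ⟩
        (suc m C suc k) * rising r (suc k) ∎

  count-sorted : ∀ m r → count (sorted r) m ≡ binomialRising r m
  count-sorted zero r = refl
  count-sorted (suc m) r =
    trans (cong₂ (λ a b → a + suc r * b) (count-sorted m r) (count-sorted m (suc r))) (sym (binomialRising-suc r m))

  count-T₄ : ∀ n → bCard n T₄ (arrangements n)
  count-T₄ n = subst (bCard n T₄) count≡ (bCard-count n)
    where
    count≡ : count (sorted 0) n ≡ arrangements n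
    count≡ = trans (count-sorted n 0) (∑<-cong (suc n) (λ k → cong ((n C k) *_) (rising-0 k)))

module Class₅ where

  open BarredRun
  open Insertion ((u 1 , u 2) ∷ (u 1 , o 2) ∷ (o 2 , u 1) ∷ [])

  run : State → ℕ
  run (allBarred r) = r
  run (mixed r) = r

  precedesAll : Bool → State → Bool
  precedesAll false _ = true
  precedesAll true = isAllBarred

  -- Every new maximum goes into the initial run of barred letters, a barred one only
  -- if all letters are barred.
  weight : Bool → (State → ℕ) → State → ℕ
  weight false g σ = ∑[ p < suc (run σ) ] g (mixed p)
  weight true g (allBarred r) = suc r * g (allBarred (suc r))
  weight true g (mixed _) = 0

  precedesAll-start : ∀ b → precedesAll b (allBarred 0) ≡ true
  precedesAll-start false = refl
  precedesAll-start true = refl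

  precedesAll-next : ∀ b c σ → precedesAll b (next c σ) ≡ mayPrecede b c ∧ precedesAll b σ
  precedesAll-next false c σ = refl
  precedesAll-next true false σ = refl
  precedesAll-next true true (allBarred _) = refl
  precedesAll-next true true (mixed _) = refl

  weight-next : ∀ b c g σ → weight b g (next c σ) ≡
    (if precedesAll b (next c σ) then g (next b (next c σ)) else 0) + (if mayFollow b c then weight b (g ∘ next c) σ else 0)
  weight-next false false g σ = refl
  weight-next false true g (allBarred _) = refl
  weight-next false true g (mixed _) = refl
  weight-next true false g σ = refl
  weight-next true true g (allBarred _) = refl
  weight-next true true g (mixed _) = refl

  weight-start : ∀ b g → weight b g (allBarred 0) ≡ g (next b (allBarred 0))
  weight-start false g = +-identityʳ _
  weight-start true g = +-identityʳ _

  open Transfer (allBarred 0) next precedesAll weight precedesAll-start precedesAll-next weight-start weight-next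

  count-mixed : ∀ m r → count (mixed r) m ≡ (r + m) C m
  count-mixed zero r = refl
  count-mixed (suc m) r = trans (+-identityʳ _) (trans (∑<-cong (suc r) (λ p → count-mixed m p)) (binomial-hockey-stick r m))

  count-allBarred : ∀ m L → count (allBarred L) m ≡ ∑[ i < suc m ] (rising L i * ((L + m) C (m ∸ i)))
  count-allBarred zero L = refl
  count-allBarred (suc m) L = begin
      ∑[ p < suc L ] count (mixed p) m + suc L * count (allBarred (suc L)) m
        ≡⟨ cong₂ _+_ (trans (∑<-cong (suc L) (λ p → count-mixed m p)) (binomial-hockey-stick L m))
                     (cong (suc L *_) (count-allBarred m (suc L))) ⟩
      (L + suc m) C suc m + suc L * ∑[ i < suc m ] (rising (suc L) i * ((suc L + m) C (m ∸ i)))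
        ≡⟨ cong₂ _+_ (+-identityʳ ((L + suc m) C suc m)) (∑<-* (suc m) (suc L) (λ i → rising (suc L) i * ((suc L + m) C (m ∸ i)))) ⟨
      ((L + suc m) C suc m + 0) + ∑[ i < suc m ] (suc L * (rising (suc L) i * ((suc L + m) C (m ∸ i))))
        ≡⟨ cong (((L + suc m) C suc m + 0) +_) (∑<-cong (suc m) (λ i →
             trans (sym (*-assoc (suc L) (rising (suc L) i) _)) (cong (λ k → rising L (suc i) * (k C (m ∸ i))) (sym (+-suc L m))))) ⟩
      ∑[ i < suc (suc m) ] (rising L i * ((L + suc m) C (suc m ∸ i))) ∎
    where open ≡-Reasoning

  count-T₅ : ∀ n → bCard n T₅ (arrangements n)
  count-T₅ n = subst (bCard n T₅) count≡ (bCard-count n)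
    where
    count≡ : count (allBarred 0) n ≡ arrangements n
    count≡ = trans (count-allBarred n 0) (∑<-cong< (suc n) term)
      where
      term : ∀ i → i < suc n → rising 0 i * (n C (n ∸ i)) ≡ (n C i) * i !
      term i i≤n = trans (cong (_* (n C (n ∸ i))) (rising-0 i))
                         (trans (*-comm (i !) _) (cong (_* i !) (sym (nCk≡nC[n∸k] (≤-pred i≤n)))))

module Class₆ where

  open SortedBars
  open Insertion ((u 1 , u 2) ∷ (u 1 , o 2) ∷ (o 2 , o 1) ∷ [])

  precedesAll : Bool → State → Bool
  precedesAll false _ = true
  precedesAll true = isAllUnbarred

  -- Every new maximum goes into the initial run of barred letters; a barred one only
  -- at its end, and only if no barred letter comes later.
  weight : Bool → (State → ℕ) → State → ℕ
  weight false g (sorted r) = ∑[ p < r ] g (unsorted p) + g (sorted r)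
  weight false g (unsorted r) = ∑[ p < suc r ] g (unsorted p)
  weight true g (sorted r) = g (sorted (suc r))
  weight true g (unsorted _) = 0

  precedesAll-start : ∀ b → precedesAll b (sorted 0) ≡ true
  precedesAll-start false = refl
  precedesAll-start true = refl

  precedesAll-next : ∀ b c σ → precedesAll b (next c σ) ≡ mayPrecede b c ∧ precedesAll b σ
  precedesAll-next false c σ = refl
  precedesAll-next true false (sorted zero) = refl
  precedesAll-next true false (sorted (suc _)) = refl
  precedesAll-next true false (unsorted _) = refl
  precedesAll-next true true (sorted _) = refl
  precedesAll-next true true (unsorted _) = refl

  weight-next : ∀ b c g σ → weight b g (next c σ) ≡
    (if precedesAll b (next c σ) then g (next b (next c σ)) else 0) + (if mayFollow b c then weight b (g ∘ next c) σ else 0)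
  weight-next false false g (sorted zero) = sym (+-identityʳ _)
  weight-next false false g (sorted (suc _)) = refl
  weight-next false false g (unsorted _) = refl
  weight-next false true g (sorted r) = +-assoc (g (unsorted 0)) _ _
  weight-next false true g (unsorted _) = refl
  weight-next true false g (sorted zero) = sym (+-identityʳ _)
  weight-next true false g (sorted (suc _)) = refl
  weight-next true false g (unsorted _) = refl
  weight-next true true g (sorted _) = refl
  weight-next true true g (unsorted _) = refl

  weight-start : ∀ b g → weight b g (sorted 0) ≡ g (next b (sorted 0))
  weight-start false g = refl
  weight-start true g = refl

  open Transfer (sorted 0) next precedesAll weight precedesAll-start precedesAll-next weight-start weight-next

  count-shift : ∀ m r → count (sorted (suc (suc r))) m + count (unsorted r) m ≡ count (sorted r) m + count (sorted (suc r)) m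
  count-shift zero r = refl
  count-shift (suc m) r = begin
      (∑< (suc (suc r)) g + k (2 + r) + k (3 + r)) + (∑< (suc r) g + 0)
        ≡⟨ cong₂ (λ a b → (a + k (2 + r) + k (3 + r)) + (b + 0))
                 (trans (∑<-suc (suc r) g) (cong (_+ g (suc r)) (∑<-suc r g))) (∑<-suc r g) ⟩
      ((S + g r + g (suc r)) + k (2 + r) + k (3 + r)) + ((S + g r) + 0)
        ≡⟨ solve 7 (λ S a b c d e f → ((S :+ a :+ b) :+ c :+ d) :+ ((S :+ a) :+ con 0)
                                    := (S :+ (S :+ a)) :+ (c :+ a) :+ (d :+ b))
                 refl S (g r) (g (suc r)) (k (2 + r)) (k (3 + r)) (k r) (k (suc r)) ⟩
      (S + (S + g r)) + (k (2 + r) + g r) + (k (3 + r) + g (suc r))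
        ≡⟨ cong₂ (λ a b → (S + (S + g r)) + a + b) (count-shift m r) (count-shift m (suc r)) ⟩
      (S + (S + g r)) + (k r + k (suc r)) + (k (suc r) + k (2 + r))
        ≡⟨ solve 7 (λ S a b c d e f → (S :+ (S :+ a)) :+ (e :+ f) :+ (f :+ c)
                                    := (S :+ e :+ f) :+ ((S :+ a) :+ f :+ c))
                 refl S (g r) (g (suc r)) (k (2 + r)) (k (3 + r)) (k r) (k (suc r)) ⟩
      (S + k r + k (suc r)) + ((S + g r) + k (suc r) + k (2 + r))
        ≡⟨ cong (λ z → (S + k r + k (suc r)) + (z + k (suc r) + k (2 + r))) (∑<-suc r g) ⟨
      (S + k r + k (suc r)) + (∑< (suc r) g + k (suc r) + k (2 + r)) ∎
    where
    open ≡-Reasoning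
    g k : ℕ → ℕ
    g p = count (unsorted p) m
    k r = count (sorted r) m
    S : ℕ
    S = ∑< r g

  count-fib : ∀ m → count (sorted 0) m ≡ fib (2 * m + 1) × count (sorted 1) m ≡ fib (suc (2 * m + 1))
  count-fib zero = refl , refl
  count-fib (suc m) = count₀ , count₁
    where
    open ≡-Reasoning
    f₀ : count (sorted 0) m ≡ fib (2 * m + 1)
    f₀ = proj₁ (count-fib m)
    f₁ : count (sorted 1) m ≡ fib (suc (2 * m + 1))
    f₁ = proj₂ (count-fib m)
    index : 2 * suc m + 1 ≡ suc (suc (2 * m + 1))
    index = solve 1 (λ m → con 2 :* (con 1 :+ m) :+ con 1 := con 2 :+ (con 2 :* m :+ con 1)) refl m
    count₀ : count (sorted 0) (suc m) ≡ fib (2 * suc m + 1)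
    count₀ = begin
        count (sorted 0) m + count (sorted 1) m  ≡⟨ cong₂ _+_ f₀ f₁ ⟩
        fib (2 * m + 1) + fib (suc (2 * m + 1))  ≡⟨ +-comm (fib (2 * m + 1)) _ ⟩
        fib (suc (suc (2 * m + 1)))              ≡⟨ cong fib index ⟨
        fib (2 * suc m + 1)                      ∎
    count₁ : count (sorted 1) (suc m) ≡ fib (suc (2 * suc m + 1))
    count₁ = begin
        ((count (unsorted 0) m + 0) + count (sorted 1) m) + count (sorted 2) m
          ≡⟨ solve 3 (λ a b c → ((a :+ con 0) :+ b) :+ c := (c :+ a) :+ b) refl
                   (count (unsorted 0) m) (count (sorted 1) m) (count (sorted 2) m) ⟩
        (count (sorted 2) m + count (unsorted 0) m) + count (sorted 1) m
          ≡⟨ cong (_+ count (sorted 1) m) (count-shift m 0) ⟩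
        (count (sorted 0) m + count (sorted 1) m) + count (sorted 1) m
          ≡⟨ cong₂ (λ a b → (a + b) + b) f₀ f₁ ⟩
        (fib (2 * m + 1) + fib (suc (2 * m + 1))) + fib (suc (2 * m + 1))
          ≡⟨ cong (_+ fib (suc (2 * m + 1))) (+-comm (fib (2 * m + 1)) _) ⟩
        fib (suc (suc (suc (2 * m + 1))))
          ≡⟨ cong (fib ∘ suc) index ⟨
        fib (suc (2 * suc m + 1)) ∎

  count-T₆ : ∀ n → bCard n T₆ (fib (2 * n + 1))
  count-T₆ n = subst (bCard n T₆) (proj₁ (count-fib n)) (bCard-count n)

module Class₇ where

  open Insertion ((u 1 , u 2) ∷ (o 1 , o 2) ∷ (u 2 , u 1) ∷ [])

  -- allBarred r: every letter is barred, and there are r of them;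
  -- mixed k: some letter is unbarred, and the word starts with k unbarred letters.
  data State : Set where
    allBarred mixed : ℕ → State

  next : Bool → State → State
  next true (allBarred r) = allBarred (suc r)
  next true (mixed _) = mixed 0
  next false (allBarred _) = mixed 1
  next false (mixed k) = mixed (suc k)

  isAllBarred : State → Bool
  isAllBarred (allBarred _) = true
  isAllBarred (mixed _) = false

  precedesAll : Bool → State → Bool
  precedesAll false = isAllBarred
  precedesAll true _ = true

  -- A barred maximum goes into the initial run of unbarred letters; an unbarred one
  -- anywhere, but only into a word of barred letters.
  weight : Bool → (State → ℕ) → State → ℕ
  weight false g (allBarred r) = g (mixed 1) + r * g (mixed 0)
  weight false g (mixed _) = 0
  weight true g (allBarred r) = g (allBarred (suc r))
  weight true g (mixed k) = ∑[ p < suc k ] g (mixed p)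

  precedesAll-start : ∀ b → precedesAll b (allBarred 0) ≡ true
  precedesAll-start false = refl
  precedesAll-start true = refl

  precedesAll-next : ∀ b c σ → precedesAll b (next c σ) ≡ mayPrecede b c ∧ precedesAll b σ
  precedesAll-next false false (allBarred _) = refl
  precedesAll-next false false (mixed _) = refl
  precedesAll-next false true (allBarred _) = refl
  precedesAll-next false true (mixed _) = refl
  precedesAll-next true c σ = refl

  weight-next : ∀ b c g σ → weight b g (next c σ) ≡
    (if precedesAll b (next c σ) then g (next b (next c σ)) else 0) + (if mayFollow b c then weight b (g ∘ next c) σ else 0)
  weight-next false false g (allBarred _) = refl
  weight-next false false g (mixed _) = refl
  weight-next false true g (allBarred r) =
    solve 3 (λ a b r → b :+ (a :+ r :* a) := b :+ (con 1 :+ r) :* a) refl (g (mixed 0)) (g (mixed 1)) r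
  weight-next false true g (mixed _) = refl
  weight-next true false g (allBarred _) = cong (g (mixed 0) +_) (+-identityʳ _)
  weight-next true false g (mixed _) = refl
  weight-next true true g (allBarred _) = sym (+-identityʳ _)
  weight-next true true g (mixed _) = refl

  weight-start : ∀ b g → weight b g (allBarred 0) ≡ g (next b (allBarred 0))
  weight-start false g = +-identityʳ _
  weight-start true g = refl

  open Transfer (allBarred 0) next precedesAll weight precedesAll-start precedesAll-next weight-start weight-next

  count-mixed₀ : ∀ m → count (mixed 0) m ≡ 1
  count-mixed₀ zero = refl
  count-mixed₀ (suc m) = trans (+-identityʳ _) (count-mixed₀ m)

  count-mixed₁ : ∀ m → count (mixed 1) m ≡ suc m
  count-mixed₁ zero = refl
  count-mixed₁ (suc m) rewrite count-mixed₀ m | count-mixed₁ m | +-identityʳ m = refl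

  count-allBarred : ∀ m r → count (allBarred r) m ≡ 1 + m * r + m * m
  count-allBarred zero r = refl
  count-allBarred (suc m) r rewrite count-mixed₀ m | count-mixed₁ m | count-allBarred m (suc r) =
    solve 2 (λ m r → (con 1 :+ m) :+ r :* con 1 :+ (con 1 :+ m :* (con 1 :+ r) :+ m :* m)
                   := con 1 :+ (con 1 :+ m) :* r :+ (con 1 :+ m) :* (con 1 :+ m)) refl m r

  count-T₇ : ∀ n → bCard n T₇ (n * n + 1)
  count-T₇ n = subst (bCard n T₇) (trans (count-allBarred n 0) square) (bCard-count n)
    where
    square : 1 + n * 0 + n * n ≡ n * n + 1
    square = solve 1 (λ n → con 1 :+ n :* con 0 :+ n :* n := n :* n :+ con 1) refl n

module Class₈ where

  open Insertion ((u 1 , u 2) ∷ (o 1 , o 2) ∷ (u 2 , o 1) ∷ [])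

  -- allUnbarred r: every letter is unbarred, and there are r of them;
  -- sorted: a nonempty block of barred letters followed by unbarred ones;
  -- unsorted k: otherwise, and the word starts with k unbarred letters.
  data State : Set where
    sorted : State
    allUnbarred unsorted : ℕ → State

  next : Bool → State → State
  next true sorted = sorted
  next true (allUnbarred _) = sorted
  next true (unsorted _) = unsorted 0
  next false sorted = unsorted 1
  next false (allUnbarred r) = allUnbarred (suc r)
  next false (unsorted k) = unsorted (suc k)

  isAllUnbarred : State → Bool
  isAllUnbarred (allUnbarred _) = true
  isAllUnbarred _ = false

  precedesAll : Bool → State → Bool
  precedesAll false = isAllUnbarred
  precedesAll true _ = true

  -- A barred maximum goes into the initial run of unbarred letters; an unbarred one
  -- only between the two blocks of a word of shape (barred)*(unbarred)*.
  weight : Bool → (State → ℕ) → State → ℕ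
  weight false g sorted = g sorted
  weight false g (allUnbarred r) = g (allUnbarred (suc r))
  weight false g (unsorted _) = 0
  weight true g sorted = g sorted
  weight true g (allUnbarred r) = g sorted + ∑[ p < r ] g (unsorted (suc p))
  weight true g (unsorted k) = ∑[ p < suc k ] g (unsorted p)

  precedesAll-start : ∀ b → precedesAll b (allUnbarred 0) ≡ true
  precedesAll-start false = refl
  precedesAll-start true = refl

  precedesAll-next : ∀ b c σ → precedesAll b (next c σ) ≡ mayPrecede b c ∧ precedesAll b σ
  precedesAll-next false false sorted = refl
  precedesAll-next false false (allUnbarred _) = refl
  precedesAll-next false false (unsorted _) = refl
  precedesAll-next false true sorted = refl
  precedesAll-next false true (allUnbarred _) = refl
  precedesAll-next false true (unsorted _) = refl
  precedesAll-next true c σ = refl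

  weight-next : ∀ b c g σ → weight b g (next c σ) ≡
    (if precedesAll b (next c σ) then g (next b (next c σ)) else 0) + (if mayFollow b c then weight b (g ∘ next c) σ else 0)
  weight-next false false g sorted = refl
  weight-next false false g (allUnbarred _) = sym (+-identityʳ _)
  weight-next false false g (unsorted _) = refl
  weight-next false true g sorted = refl
  weight-next false true g (allUnbarred _) = refl
  weight-next false true g (unsorted _) = refl
  weight-next true false g sorted = cong (g (unsorted 0) +_) (+-identityʳ _)
  weight-next true false g (allUnbarred _) = refl
  weight-next true false g (unsorted _) = refl
  weight-next true true g sorted = sym (+-identityʳ _)
  weight-next true true g (allUnbarred _) = sym (+-identityʳ _)
  weight-next true true g (unsorted _) = refl

  weight-start : ∀ b g → weight b g (allUnbarred 0) ≡ g (next b (allUnbarred 0))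
  weight-start false g = refl
  weight-start true g = +-identityʳ _

  open Transfer (allUnbarred 0) next precedesAll weight precedesAll-start precedesAll-next weight-start weight-next

  count-sorted : ∀ m → count sorted m ≡ 2 ^ m
  count-sorted zero = refl
  count-sorted (suc m) = trans (cong₂ _+_ (count-sorted m) (count-sorted m)) (cong (2 ^ m +_) (sym (+-identityʳ (2 ^ m))))

  count-unsorted : ∀ m r → count (unsorted r) m ≡ (r + m) C m
  count-unsorted zero r = refl
  count-unsorted (suc m) r = trans (∑<-cong (suc r) (λ p → count-unsorted m p)) (binomial-hockey-stick r m)

  partialBinomialSum : ℕ → ℕ → ℕ
  partialBinomialSum N k = ∑[ i < suc k ] (N C i)

  count-allUnbarred : ∀ m r → count (allUnbarred r) m + suc m ≡ 2 ^ m + partialBinomialSum (r + m) m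
  count-allUnbarred zero r = refl
  count-allUnbarred (suc m) r = begin
      (count (allUnbarred (suc r)) m + (count sorted m + ∑[ p < r ] count (unsorted (suc p)) m)) + suc (suc m)
        ≡⟨ cong₂ (λ x y → (count (allUnbarred (suc r)) m + (x + y)) + suc (suc m))
                 (count-sorted m) (∑<-cong r (λ p → count-unsorted m (suc p))) ⟩
      (count (allUnbarred (suc r)) m + (2 ^ m + S)) + suc (suc m)
        ≡⟨ solve 4 (λ f t S m → (f :+ (t :+ S)) :+ (con 2 :+ m) := (f :+ (con 1 :+ m)) :+ (t :+ (con 1 :+ S)))
                 refl (count (allUnbarred (suc r)) m) (2 ^ m) S m ⟩
      (count (allUnbarred (suc r)) m + suc m) + (2 ^ m + (1 + S))
        ≡⟨ cong₂ (λ x y → x + (2 ^ m + (y + S))) (count-allUnbarred m (suc r)) (sym (nCn≡1 m)) ⟩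
      (2 ^ m + partialBinomialSum (suc r + m) m) + (2 ^ m + ∑[ p < suc r ] ((p + m) C m))
        ≡⟨ cong (λ z → (2 ^ m + partialBinomialSum (suc r + m) m) + (2 ^ m + z))
                (trans (binomial-hockey-stick r m) (cong (_C suc m) (+-suc r m))) ⟩
      (2 ^ m + partialBinomialSum (suc r + m) m) + (2 ^ m + (suc r + m) C suc m)
        ≡⟨ solve 3 (λ t x y → (t :+ x) :+ (t :+ y) := (t :+ (t :+ con 0)) :+ (x :+ y))
                 refl (2 ^ m) (partialBinomialSum (suc r + m) m) ((suc r + m) C suc m) ⟩
      2 ^ suc m + (partialBinomialSum (suc r + m) m + (suc r + m) C suc m)
        ≡⟨ cong (2 ^ suc m +_) (∑<-suc (suc m) ((suc r + m) C_)) ⟨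
      2 ^ suc m + partialBinomialSum (suc r + m) (suc m)
        ≡⟨ cong (λ z → 2 ^ suc m + partialBinomialSum z (suc m)) (+-suc r m) ⟨
      2 ^ suc m + partialBinomialSum (r + suc m) (suc m) ∎
    where
    open ≡-Reasoning
    S : ℕ
    S = ∑[ p < r ] ((suc p + m) C m)

  count-T₈ : ∀ n → bCard n T₈ (2 ^ (n + 1) ∸ (n + 1))
  count-T₈ n = subst (bCard n T₈) count≡ (bCard-count n)
    where
    open ≡-Reasoning
    C₀ : ℕ
    C₀ = count (allUnbarred 0) n
    count≡ : C₀ ≡ 2 ^ (n + 1) ∸ (n + 1)
    count≡ = begin
        C₀                               ≡⟨ m+n∸n≡m C₀ (n + 1) ⟨
        C₀ + (n + 1) ∸ (n + 1)           ≡⟨ cong (λ k → C₀ + k ∸ (n + 1)) (+-comm n 1) ⟩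
        C₀ + suc n ∸ (n + 1)             ≡⟨ cong (_∸ (n + 1)) (count-allUnbarred n 0) ⟩
        2 ^ n + partialBinomialSum n n ∸ (n + 1) ≡⟨ cong (λ k → 2 ^ n + k ∸ (n + 1)) (∑<-binomial n) ⟩
        2 ^ n + 2 ^ n ∸ (n + 1)          ≡⟨ cong (λ k → 2 ^ n + k ∸ (n + 1)) (+-identityʳ (2 ^ n)) ⟨
        2 ^ suc n ∸ (n + 1)              ≡⟨ cong (λ k → 2 ^ k ∸ (n + 1)) (+-comm 1 n) ⟩
        2 ^ (n + 1) ∸ (n + 1)            ∎

module Class₉ where

  open Insertion ((u 1 , u 2) ∷ (u 2 , o 1) ∷ (o 2 , u 1) ∷ [])

  -- allBarred a: a letters, all barred; allUnbarred: nonempty, all unbarred;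
  -- sorted: barred letters, then unbarred ones, both nonempty;
  -- unsorted t: none of these, and the word ends with t barred letters.
  data State : Set where
    allBarred unsorted : ℕ → State
    allUnbarred sorted : State

  next : Bool → State → State
  next true (allBarred a) = allBarred (suc a)
  next false (allBarred zero) = allUnbarred
  next false (allBarred (suc a)) = unsorted (suc a)
  next true allUnbarred = sorted
  next false allUnbarred = allUnbarred
  next true sorted = sorted
  next false sorted = unsorted 0
  next _ (unsorted t) = unsorted t

  precedesAll : Bool → State → Bool
  precedesAll false (allBarred zero) = true
  precedesAll false allUnbarred = true
  precedesAll false _ = false
  precedesAll true (allBarred _) = true
  precedesAll true _ = false

  -- An unbarred maximum goes only between the two blocks of a word of shape
  -- (barred)*(unbarred)*; a barred one only into the final run of barred letters.
  weight : Bool → (State → ℕ) → State → ℕ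
  weight false g (allBarred zero) = g allUnbarred
  weight false g (allBarred (suc _)) = g sorted
  weight false g allUnbarred = g allUnbarred
  weight false g sorted = g sorted
  weight false g (unsorted _) = 0
  weight true g (allBarred a) = suc a * g (allBarred (suc a))
  weight true g allUnbarred = g (unsorted 1)
  weight true g sorted = g (unsorted 1)
  weight true g (unsorted t) = suc t * g (unsorted (suc t))

  precedesAll-start : ∀ b → precedesAll b (allBarred 0) ≡ true
  precedesAll-start false = refl
  precedesAll-start true = refl

  precedesAll-next : ∀ b c σ → precedesAll b (next c σ) ≡ mayPrecede b c ∧ precedesAll b σ
  precedesAll-next false false (allBarred zero) = refl
  precedesAll-next false false (allBarred (suc _)) = refl
  precedesAll-next false false allUnbarred = refl
  precedesAll-next false false sorted = refl
  precedesAll-next false false (unsorted _) = refl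
  precedesAll-next false true (allBarred _) = refl
  precedesAll-next false true allUnbarred = refl
  precedesAll-next false true sorted = refl
  precedesAll-next false true (unsorted _) = refl
  precedesAll-next true false (allBarred zero) = refl
  precedesAll-next true false (allBarred (suc _)) = refl
  precedesAll-next true false allUnbarred = refl
  precedesAll-next true false sorted = refl
  precedesAll-next true false (unsorted _) = refl
  precedesAll-next true true (allBarred _) = refl
  precedesAll-next true true allUnbarred = refl
  precedesAll-next true true sorted = refl
  precedesAll-next true true (unsorted _) = refl

  weight-next : ∀ b c g σ → weight b g (next c σ) ≡
    (if precedesAll b (next c σ) then g (next b (next c σ)) else 0) + (if mayFollow b c then weight b (g ∘ next c) σ else 0)
  weight-next false false g (allBarred zero) = sym (+-identityʳ _)
  weight-next false false g (allBarred (suc _)) = refl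
  weight-next false false g allUnbarred = sym (+-identityʳ _)
  weight-next false false g sorted = refl
  weight-next false false g (unsorted _) = refl
  weight-next false true g (allBarred zero) = refl
  weight-next false true g (allBarred (suc _)) = refl
  weight-next false true g allUnbarred = refl
  weight-next false true g sorted = refl
  weight-next false true g (unsorted _) = refl
  weight-next true false g (allBarred zero) = sym (+-identityʳ _)
  weight-next true false g (allBarred (suc _)) = refl
  weight-next true false g allUnbarred = refl
  weight-next true false g sorted = +-identityʳ _
  weight-next true false g (unsorted _) = refl
  weight-next true true g (allBarred _) = refl
  weight-next true true g allUnbarred = refl
  weight-next true true g sorted = refl
  weight-next true true g (unsorted _) = refl

  weight-start : ∀ b g → weight b g (allBarred 0) ≡ g (next b (allBarred 0))
  weight-start false g = refl
  weight-start true g = +-identityʳ _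

  open Transfer (allBarred 0) next precedesAll weight precedesAll-start precedesAll-next weight-start weight-next

  count-unsorted : ∀ m t → count (unsorted t) m ≡ rising t m
  count-unsorted zero t = refl
  count-unsorted (suc m) t = cong (suc t *_) (count-unsorted m (suc t))

  factorialSum : ℕ → ℕ
  factorialSum m = ∑[ q < suc m ] (q !)

  count-allUnbarred : ∀ m → count allUnbarred m ≡ factorialSum m
  count-sorted : ∀ m → count sorted m ≡ factorialSum m
  count-allUnbarred zero = refl
  count-allUnbarred (suc m) = trans (cong₂ _+_ (count-allUnbarred m) (trans (count-unsorted m 1) (rising-1 m)))
                                    (sym (∑<-suc (suc m) _!))
  count-sorted zero = refl
  count-sorted (suc m) = trans (cong₂ _+_ (count-sorted m) (trans (count-unsorted m 1) (rising-1 m)))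
                               (sym (∑<-suc (suc m) _!))

  risingConvolution : ℕ → ℕ → ℕ
  risingConvolution a t = ∑[ i < suc t ] (rising a i * (t ∸ i) !)

  risingConvolution-suc : ∀ a t → risingConvolution a (suc t) ≡ suc t ! + suc a * risingConvolution (suc a) t
  risingConvolution-suc a t = cong₂ _+_ (+-identityʳ (suc t !))
    (trans (∑<-cong (suc t) (λ i → *-assoc (suc a) (rising (suc a) i) ((t ∸ i) !)))
           (∑<-* (suc t) (suc a) (λ i → rising (suc a) i * (t ∸ i) !)))

  ∑<-risingConvolution : ∀ a m → ∑< (suc m) (risingConvolution a) ≡ factorialSum m + suc a * ∑< m (risingConvolution (suc a))
  ∑<-risingConvolution a m = begin
      risingConvolution a 0 + ∑[ t < m ] risingConvolution a (suc t)
        ≡⟨ cong₂ _+_ (+-identityʳ _) (∑<-cong m (risingConvolution-suc a)) ⟩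
      1 + ∑[ t < m ] (suc t ! + suc a * risingConvolution (suc a) t)
        ≡⟨ cong (1 +_) (∑<-+ m (λ t → suc t !) (λ t → suc a * risingConvolution (suc a) t)) ⟩
      1 + (∑[ t < m ] (suc t !) + ∑[ t < m ] (suc a * risingConvolution (suc a) t))
        ≡⟨ +-assoc 1 (∑[ t < m ] (suc t !)) _ ⟨
      factorialSum m + ∑[ t < m ] (suc a * risingConvolution (suc a) t)
        ≡⟨ cong (factorialSum m +_) (∑<-* m (suc a) (risingConvolution (suc a))) ⟩
      factorialSum m + suc a * ∑< m (risingConvolution (suc a)) ∎
    where open ≡-Reasoning

  count-allBarred : ∀ m a → count (allBarred a) m ≡ rising a m + ∑< m (risingConvolution a)
  count-allBarred zero a = refl
  count-allBarred (suc m) a = begin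
      weight false (λ σ → count σ m) (allBarred a) + suc a * count (allBarred (suc a)) m
        ≡⟨ cong₂ _+_ (unbarred-part a) (cong (suc a *_) (count-allBarred m (suc a))) ⟩
      factorialSum m + suc a * (rising (suc a) m + ∑< m (risingConvolution (suc a)))
        ≡⟨ cong (factorialSum m +_) (*-distribˡ-+ (suc a) (rising (suc a) m) _) ⟩
      factorialSum m + (rising a (suc m) + suc a * ∑< m (risingConvolution (suc a)))
        ≡⟨ solve 3 (λ x r y → x :+ (r :+ y) := r :+ (x :+ y)) refl
                 (factorialSum m) (rising a (suc m)) (suc a * ∑< m (risingConvolution (suc a))) ⟩
      rising a (suc m) + (factorialSum m + suc a * ∑< m (risingConvolution (suc a)))
        ≡⟨ cong (rising a (suc m) +_) (∑<-risingConvolution a m) ⟨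
      rising a (suc m) + ∑< (suc m) (risingConvolution a) ∎
    where
    open ≡-Reasoning
    unbarred-part : ∀ a → weight false (λ σ → count σ m) (allBarred a) ≡ factorialSum m
    unbarred-part zero = count-allUnbarred m
    unbarred-part (suc _) = count-sorted m

  count-T₉ : ∀ n → bCard n T₉ (n ! + sumFromTo 1 n (λ j → sumFromTo 0 (n ∸ j) (λ p → p ! * (n ∸ j ∸ p) !)))
  count-T₉ n = subst (bCard n T₉) count≡ (bCard-count n)
    where
    convolution : ℕ → ℕ
    convolution t = sumFromTo 0 t (λ p → p ! * (t ∸ p) !)
    convolution≡ : ∀ t → convolution t ≡ risingConvolution 0 t
    convolution≡ t = trans (sumFromTo-0 t _) (∑<-cong (suc t) (λ i → cong (_* (t ∸ i) !) (sym (rising-0 i))))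
    sum≡ : sumFromTo 1 n (λ j → convolution (n ∸ j)) ≡ ∑< n (risingConvolution 0)
    sum≡ = trans (sumFromTo-1 n (λ j → convolution (n ∸ j)))
                 (trans (sym (∑<-reverse n convolution)) (∑<-cong n convolution≡))
    count≡ : count (allBarred 0) n ≡ n ! + sumFromTo 1 n (λ j → convolution (n ∸ j))
    count≡ = trans (count-allBarred n 0) (cong₂ _+_ (rising-0 n) (sym sum≡))

module Class₁₀ where

  open Insertion ((u 1 , o 2) ∷ (o 1 , u 2) ∷ (u 2 , o 1) ∷ [])

  -- allUnbarred r: every letter is unbarred, and there are r of them;
  -- mixed r: some letter is barred, and the word starts with r barred letters.
  data State : Set where
    allUnbarred mixed : ℕ → State

  next : Bool → State → State
  next false (allUnbarred r) = allUnbarred (suc r)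
  next false (mixed _) = mixed 0
  next true (allUnbarred _) = mixed 1
  next true (mixed r) = mixed (suc r)

  isAllUnbarred : State → Bool
  isAllUnbarred (allUnbarred _) = true
  isAllUnbarred (mixed _) = false

  precedesAll : Bool → State → Bool
  precedesAll false = isAllUnbarred
  precedesAll true _ = true

  -- An unbarred maximum goes anywhere, but only into a word of unbarred letters; a
  -- barred one into the initial run of barred letters.
  weight : Bool → (State → ℕ) → State → ℕ
  weight false g (allUnbarred r) = suc r * g (allUnbarred (suc r))
  weight false g (mixed _) = 0
  weight true g (allUnbarred _) = g (mixed 1)
  weight true g (mixed r) = suc r * g (mixed (suc r))

  precedesAll-start : ∀ b → precedesAll b (allUnbarred 0) ≡ true
  precedesAll-start false = refl
  precedesAll-start true = refl

  precedesAll-next : ∀ b c σ → precedesAll b (next c σ) ≡ mayPrecede b c ∧ precedesAll b σ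
  precedesAll-next false false (allUnbarred _) = refl
  precedesAll-next false false (mixed _) = refl
  precedesAll-next false true (allUnbarred _) = refl
  precedesAll-next false true (mixed _) = refl
  precedesAll-next true c σ = refl

  weight-next : ∀ b c g σ → weight b g (next c σ) ≡
    (if precedesAll b (next c σ) then g (next b (next c σ)) else 0) + (if mayFollow b c then weight b (g ∘ next c) σ else 0)
  weight-next false false g (allUnbarred _) = refl
  weight-next false false g (mixed _) = refl
  weight-next false true g (allUnbarred _) = refl
  weight-next false true g (mixed _) = refl
  weight-next true false g (allUnbarred _) = sym (+-identityʳ _)
  weight-next true false g (mixed _) = refl
  weight-next true true g (allUnbarred _) = cong (g (mixed 2) +_) (+-identityʳ _)
  weight-next true true g (mixed _) = refl

  weight-start : ∀ b g → weight b g (allUnbarred 0) ≡ g (next b (allUnbarred 0))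
  weight-start false g = +-identityʳ _
  weight-start true g = refl

  open Transfer (allUnbarred 0) next precedesAll weight precedesAll-start precedesAll-next weight-start weight-next

  count-mixed : ∀ m r → count (mixed r) m ≡ rising r m
  count-mixed zero r = refl
  count-mixed (suc m) r = cong (suc r *_) (count-mixed m (suc r))

  count-allUnbarred : ∀ m L → L ! * count (allUnbarred L) m ≡ ∑[ i < suc m ] ((L + i) ! * (m ∸ i) !)
  count-allUnbarred zero L = trans (*-identityʳ _) (trans (cong _! (sym (+-identityʳ L))) (sym (trans (+-identityʳ _) (*-identityʳ _))))
  count-allUnbarred (suc m) L = begin
      L ! * (suc L * count (allUnbarred (suc L)) m + count (mixed 1) m)
        ≡⟨ *-distribˡ-+ (L !) _ _ ⟩
      L ! * (suc L * count (allUnbarred (suc L)) m) + L ! * count (mixed 1) m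
        ≡⟨ cong₂ _+_ (trans (sym (*-assoc (L !) (suc L) _)) (cong (_* count (allUnbarred (suc L)) m) (*-comm (L !) (suc L))))
                     (cong (L ! *_) (trans (count-mixed m 1) (rising-1 m))) ⟩
      suc L ! * count (allUnbarred (suc L)) m + L ! * suc m !
        ≡⟨ cong (_+ L ! * suc m !) (count-allUnbarred m (suc L)) ⟩
      ∑[ i < suc m ] ((suc L + i) ! * (m ∸ i) !) + L ! * suc m !
        ≡⟨ +-comm _ (L ! * suc m !) ⟩
      L ! * suc m ! + ∑[ i < suc m ] ((suc L + i) ! * (m ∸ i) !)
        ≡⟨ cong₂ _+_ (cong (λ k → k ! * suc m !) (+-identityʳ L))
                     (∑<-cong (suc m) (λ i → cong (λ k → k ! * (m ∸ i) !) (+-suc L i))) ⟨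
      ∑[ i < suc (suc m) ] ((L + i) ! * (suc m ∸ i) !) ∎
    where open ≡-Reasoning

  count-T₁₀ : ∀ n → ∃ λ k → bCard n T₁₀ k × ℕtoℚ k ≡ ℕtoℚ (n !) *ℚ sumFromToℚ 0 n (λ j → recip (n C j))
  count-T₁₀ n = count (allUnbarred 0) n , bCard-count n , value
    where
    h : ℕ → ℕ
    h j = j ! * (n ∸ j) !
    count≡ : count (allUnbarred 0) n ≡ sumFromTo 0 n h
    count≡ = trans (sym (+-identityʳ _)) (trans (count-allUnbarred n 0) (sym (sumFromTo-0 n h)))
    term : ∀ j → j ≤ n → ℕtoℚ (n !) *ℚ recip (n C j) ≡ ℕtoℚ (h j)
    term j j≤n = trans (cong (λ k → ℕtoℚ k *ℚ recip (n C j)) n!≡) (ℕtoℚ-*-recip (h j) (n C j) {{nonZero}})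
      where
      n!≡ : n ! ≡ h j * (n C j)
      n!≡ = sym (trans (*-comm (h j) (n C j)) (nCk*k![n∸k]!≡n! n j j≤n))
      nonZero : NonZero (n C j)
      nonZero = m*n≢0⇒m≢0 (n C j) {{subst NonZero (sym (nCk*k![n∸k]!≡n! n j j≤n)) (n !≢0)}}
    value : ℕtoℚ (count (allUnbarred 0) n) ≡ ℕtoℚ (n !) *ℚ sumFromToℚ 0 n (λ j → recip (n C j))
    value = trans (cong ℕtoℚ count≡) (sym (ℕtoℚ-*-sumFromToℚ-0 (n !) n (λ j → recip (n C j)) h term))

mainTheorem2 : ∀ (n : ℕ) →
      bCard n T₁ (sumFromTo 0 n (λ d → compFactSum (suc d) (n ∸ d)))
    × bCard n T₂ (catalan (suc n))
    × (∃ λ k → bCard n T₃ k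
         × ℕtoℚ k ≡ ℕtoℚ (n !) +ℚ ℕtoℚ (n !) *ℚ sumFromToℚ 1 n recip)
    × (∃ λ k → bCard n T₄ k × bCard n T₅ k
         × ℕtoℚ k ≡ ℕtoℚ (n !) *ℚ sumFromToℚ 0 n (λ j → recip (j !)))
    × bCard n T₆ (fib (2 * n + 1))
    × bCard n T₇ (n * n + 1)
    × bCard n T₈ (2 ^ (n + 1) ∸ (n + 1))
    × bCard n T₉ (n ! + sumFromTo 1 n (λ j → sumFromTo 0 (n ∸ j) (λ p → p ! * (n ∸ j ∸ p) !)))
    × (∃ λ k → bCard n T₁₀ k
         × ℕtoℚ k ≡ ℕtoℚ (n !) *ℚ sumFromToℚ 0 n (λ j → recip (n C j)))
mainTheorem2 n =
    Class₁.count-T₁ n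
  , Class₂.count-T₂ n
  , Class₃.count-T₃ n
  , (arrangements n , Class₄.count-T₄ n , Class₅.count-T₅ n , ℕtoℚ-arrangements n)
  , Class₆.count-T₆ n
  , Class₇.count-T₇ n
  , Class₈.count-T₈ n
  , Class₉.count-T₉ n
  , Class₁₀.count-T₁₀ n
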